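{- There exists a language $L$ such that $L\in\mathrm{L}$, $L\notin\mathrm{CFL}/n$, and $L$ is $\mathrm{CFL}$-immune.
   Context: $\mathrm{L}$ is the family of languages recognized by deterministic Turing machines with a read-only input tape and a logarithmic-space bounded work tape. $\mathrm{CFL}$ is the family of context-free languages. For a family ${\cal C}$ of languages, ${\cal C}/n$ is the family of languages $L$ over an alphabet $\Sigma$ for which there exist an alphabet $\Gamma$, a function $h:\mathbb{N}\to\Gamma^*$ with $|h(n)|=n$ for all $n$, and a language $A\in{\cal C}$ over the alphabet $\Sigma\times\Gamma$ such that for every $x\in\Sigma^*$: $x\in L$ iff $\left[\begin{smallmatrix}x\\ h(|x|)\end{smallmatrix}\right]\in A$, where for $x=x_1\cdots x_n$, $y=y_1\cdots y_n$ the string $\left[\begin{smallmatrix}x\\ y\end{smallmatrix}\right]$ is $(x_1,y_1)\cdots(x_n,y_n)$. A language $L$ is ${\cal C}$-immune if $L$ is infinite and no infinite subset of $L$ belongs to ${\cal C}$. -}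

module Defs where

open import Data.Nat using (ℕ; zero; suc; _+_; _*_; _≤_)
open import Data.Nat.Logarithm using (⌊log₂_⌋)
open import Data.Fin using (Fin)
open import Data.List using (List; []; _∷_; _++_; length; zip; [_])
open import Data.List.Membership.Propositional using (_∈_)
open import Data.Maybe using (Maybe; just; nothing)
open import Data.Product using (Σ; ∃; ∃-syntax; _×_; _,_; proj₁; proj₂)
open import Data.Sum using (_⊎_; inj₁; inj₂)
open import Relation.Binary.PropositionalEquality using (_≡_)
open import Relation.Nullary using (¬_)
open import Function.Bundles using (_⇔_)

Language : Set → Set₁
Language Al = List Al → Set

_≐_ : {Al : Set} → Language Al → Language Al → Set
L ≐ L' = ∀ w → L w ⇔ L' w

_⊆L_ : {Al : Set} → Language Al → Language Al → Set
L ⊆L L' = ∀ w → L w → L' w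

FiniteLang : {Al : Set} → Language Al → Set
FiniteLang {Al} L = ∃[ ws ] (∀ (w : List Al) → L w → w ∈ ws)

InfiniteLang : {Al : Set} → Language Al → Set
InfiniteLang L = ¬ FiniteLang L

-- Context-free grammars with nonterminals Fin m and terminals in T.
-- (Only the finitely many terminals occurring in the productions matter.)

record CFG (T : Set) : Set where
  field
    m     : ℕ
    start : Fin m
    prods : List (Fin m × List (Fin m ⊎ T))

module _ {T : Set} (G : CFG T) where
  open CFG G

  data DerivesSeq : List (Fin m ⊎ T) → List T → Set where
    d-nil  : DerivesSeq [] []
    d-term : ∀ {a α w} → DerivesSeq α w → DerivesSeq (inj₂ a ∷ α) (a ∷ w)
    d-nt   : ∀ {A β α u v} → (A , β) ∈ prods → DerivesSeq β u →
             DerivesSeq α v → DerivesSeq (inj₁ A ∷ α) (u ++ v)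

  LangOf : Language T
  LangOf w = DerivesSeq [ inj₁ start ] w

IsCFL : {T : Set} → Language T → Set
IsCFL {T} L = Σ (CFG T) λ G → L ≐ LangOf G

track : {Al Γ : Set} → List Al → List Γ → List (Al × Γ)
track = zip

InAdvice : ({T : Set} → Language T → Set) → {Al : Set} → Language Al → Set₁
InAdvice C {Al} L =
  ∃[ g ] Σ (ℕ → List (Fin g)) λ h →
    (∀ n → length (h n) ≡ n) ×
    Σ (Language (Al × Fin g)) λ A →
      C A × (∀ x → L x ⇔ A (track x (h (length x))))

Immune : ({T : Set} → Language T → Set) → {Al : Set} → Language Al → Set₁
Immune C L = InfiniteLang L ×
  (∀ S → S ⊆L L → ¬ (InfiniteLang S × C S))

-- Deterministic Turing machines with a read-only two-way input tape
-- (with endmarkers) and one one-way-infinite read/write work tape.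

data Move : Set where
  left stay right : Move

record DTM (Al : Set) : Set where
  field
    q      : ℕ
    g      : ℕ
    blank  : Fin g
    init   : Fin q
    accept : Fin q
    reject : Fin q
    -- input symbol (nothing = endmarker), work symbol ↦
    -- new state, input-head move, symbol written, work-head move
    δ      : Fin q → Maybe Al → Fin g → Fin q × Move × Fin g × Move

record Config {Al : Set} (M : DTM Al) : Set where
  constructor config
  open DTM M
  field
    state   : Fin q
    inHead  : ℕ             -- 0 = left endmarker, n+1 = right endmarker
    tape    : ℕ → Fin g
    wkHead  : ℕ

readInput : {Al : Set} → List Al → ℕ → Maybe Al
readInput x zero = nothing
readInput [] (suc i) = nothing
readInput (a ∷ x) (suc zero) = just a
readInput (a ∷ x) (suc (suc i)) = readInput x (suc i)

isHalting : ∀ {q} → Fin q → Fin q → Fin q → Set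
isHalting s a r = (s ≡ a) ⊎ (s ≡ r)

open import Data.Nat using (_≟_; _<ᵇ_)
open import Data.Bool using (Bool; true; false; if_then_else_)
import Data.Fin as F

moveIn : ℕ → Move → ℕ → ℕ
moveIn n left zero = zero
moveIn n left (suc i) = i
moveIn n stay i = i
moveIn n right i = if i <ᵇ suc n then suc i else i

moveWk : Move → ℕ → ℕ
moveWk left zero = zero
moveWk left (suc i) = i
moveWk stay i = i
moveWk right i = suc i

write : ∀ {g} → (ℕ → Fin g) → ℕ → Fin g → ℕ → Fin g
write t p c i with i ≟ p
... | Relation.Nullary.yes _ = c
... | Relation.Nullary.no _ = t i

module _ {Al : Set} (M : DTM Al) (x : List Al) where
  open DTM M

  initConfig : Config M
  initConfig = config init 0 (λ _ → blank) 0

  step : Config M → Config M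
  step c@(config s i t p) with F._≟_ s accept | F._≟_ s reject
  ... | Relation.Nullary.yes _ | _ = c
  ... | Relation.Nullary.no _ | Relation.Nullary.yes _ = c
  ... | Relation.Nullary.no _ | Relation.Nullary.no _ with δ s (readInput x i) (t p)
  ...   | (s' , mi , c' , mw) =
            config s' (moveIn (length x) mi i) (write t p c') (moveWk mw p)

  run : ℕ → Config M
  run zero = initConfig
  run (suc n) = step (run n)

  Accepts : Set
  Accepts = ∃[ t ] (Config.state (run t) ≡ accept)

Recognizes : {Al : Set} → DTM Al → Language Al → Set
Recognizes M L = ∀ x → L x ⇔ Accepts M x

LogSpaceBounded : {Al : Set} → DTM Al → Set
LogSpaceBounded M = ∃[ c ] ∀ x t →
  Config.wkHead (run M x t) ≤ c * ⌊log₂ (length x) ⌋ + c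

InLogSpace : {Al : Set} → Language Al → Set
InLogSpace {Al} L = Σ (DTM Al) λ M → Recognizes M L × LogSpaceBounded M

module Submission where

-- The witness Lang consists of the words of length 2 ^ k with period k, over 8 letters.
-- A logspace machine counts the length of its input in binary and, if the counter reads
-- 0 ^ k 1, reuses it as a ruler of length k to compare every letter with the one k places on.
-- Advice does not help a grammar: among the 8 ^ k words of Lang of length n = 2 ^ k, two have
-- derivations (on the same advice) using the same nonterminal for a factor at the same place
-- and of the same length, chosen between n / (2 b) and n / 2 for the branching b of the grammar,
-- since there are only about m n² such choices; exchanging the two factors yields a derivable,
-- hence periodic, word, and periodicity forces the two words to coincide.  A context-free
-- subset of Lang is finite, since pumping a long word down by less than half its length would
-- give a length strictly between two consecutive powers of two.

open import Defs
open import Data.Nat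
open import Data.Nat.Properties
open import Data.Nat.DivMod
open import Data.Nat.Logarithm
open import Data.Nat.ListAction using (sum)
open import Data.Nat.Tactic.RingSolver using (solve-∀)
open import Data.Fin using (Fin; zero; suc; toℕ; fromℕ<; combine; finToFun; funToFin)
import Data.Fin as Fin
open import Data.Fin.Properties
  using (pigeonhole; combine-injective; toℕ-fromℕ<; toℕ<n; funToFin-finToFin; fromℕ<-cong; fromℕ<-toℕ)
open import Data.List hiding (lookup; sum)
open import Data.List.Properties
open import Data.List.Membership.Propositional using (_∈_)
open import Data.List.Membership.Propositional.Properties using (∈-map⁺; ∈-++⁺ˡ; ∈-++⁺ʳ; ∈-concatMap⁺; ∈-allFin)
open import Data.List.Relation.Unary.Any using (here; there)
import Data.List.Relation.Unary.Any as Any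
open import Data.Maybe using (Maybe; just; nothing)
open import Data.Bool using (Bool; true; false; if_then_else_)
open import Data.Product using (Σ; _×_; _,_; proj₁; proj₂)
open import Data.Sum using (_⊎_; inj₁; inj₂; [_,_]′)
open import Data.Empty using (⊥; ⊥-elim)
open import Relation.Nullary using (¬_; yes; no; does)
open import Relation.Binary.PropositionalEquality hiding ([_])
open import Relation.Binary.Definitions using (tri<; tri≈; tri>)
open import Function.Bundles using (Equivalence; _⇔_; mk⇔)

++-regroup : ∀ {A : Set} (a b t c d : List A) → a ++ (b ++ t ++ c) ++ d ≡ (a ++ b) ++ t ++ (c ++ d)
++-regroup a b t c d rewrite ++-assoc a b (t ++ c ++ d) | ++-assoc b (t ++ c) d | ++-assoc t c d = refl

module Derivations {T : Set} (G : CFG T) where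
  open CFG G

  Symbol : Set
  Symbol = Fin m ⊎ T

  Derives : List Symbol → List T → Set
  Derives = DerivesSeq G

  Derives₁ : Fin m → List T → Set
  Derives₁ N = Derives [ inj₁ N ]

  size : ∀ {α w} → Derives α w → ℕ
  size d-nil = 0
  size (d-term D) = size D
  size (d-nt _ D₁ D₂) = suc (size D₁ + size D₂)

  derives-∷ : ∀ {N t α v} → Derives₁ N t → Derives α v → Derives (inj₁ N ∷ α) (t ++ v)
  derives-∷ (d-nt {u = u} p D d-nil) Dα =
    subst (Derives _) (cong (_++ _) (sym (++-identityʳ u))) (d-nt p D Dα)

  production-derives : ∀ {N β s} → (N , β) ∈ prods → Derives β s → Derives₁ N (s ++ [])
  production-derives p D = d-nt p D d-nil

  record Occurrence (α : List Symbol) (w : List T) : Set where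
    field
      N        : Fin m
      β        : List Symbol
      prod     : (N , β) ∈ prods
      yield    : List T
      subtree  : Derives β yield
      pre suf  : List T
      splits   : w ≡ pre ++ yield ++ suf
      plug     : ∀ t → Derives₁ N t → Derives α (pre ++ t ++ suf)

  open Occurrence

  len : ∀ {α w} → Occurrence α w → ℕ
  len o = length (yield o)

  occurrence-at-head : ∀ {A β u α v} → (A , β) ∈ prods → Derives β u → Derives α v →
                       Occurrence (inj₁ A ∷ α) (u ++ v)
  occurrence-at-head {u = u} {v = v} p D Dα = record
    { prod = p ; yield = u ; subtree = D ; pre = [] ; suf = v
    ; splits = refl ; plug = λ t Dt → derives-∷ Dt Dα }

  occurrence-after-terminal : ∀ {a α w} → Occurrence α w → Occurrence (inj₂ a ∷ α) (a ∷ w)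
  occurrence-after-terminal {a} o = record
    { prod = prod o ; subtree = subtree o ; suf = suf o
    ; pre = a ∷ pre o ; splits = cong (a ∷_) (splits o) ; plug = λ t Dt → d-term (plug o t Dt) }

  occurrence-after-nonterminal : ∀ {A β u α v} → (A , β) ∈ prods → Derives β u → Occurrence α v →
                                 Occurrence (inj₁ A ∷ α) (u ++ v)
  occurrence-after-nonterminal {u = u} p D o = record
    { prod = prod o ; subtree = subtree o ; suf = suf o
    ; pre = u ++ pre o
    ; splits = trans (cong (u ++_) (splits o)) (sym (++-assoc u (pre o) _))
    ; plug = λ t Dt → subst (Derives _) (sym (++-assoc u (pre o) _)) (d-nt p D (plug o t Dt)) }

  nest : ∀ {α w} (o : Occurrence α w) → Occurrence (β o) (yield o) → Occurrence α w
  nest o o′ = record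
    { prod = prod o′ ; subtree = subtree o′
    ; pre = pre o ++ pre o′ ; suf = suf o′ ++ suf o
    ; splits = trans (splits o) (trans (cong (λ z → pre o ++ z ++ suf o) (splits o′))
                                       (++-regroup (pre o) (pre o′) (yield o′) (suf o′) (suf o)))
    ; plug = λ t Dt → subst (Derives _) (plugged t)
                        (plug o _ (production-derives (prod o) (plug o′ t Dt))) }
    where
      plugged : ∀ t → pre o ++ ((pre o′ ++ t ++ suf o′) ++ []) ++ suf o
                    ≡ (pre o ++ pre o′) ++ t ++ (suf o′ ++ suf o)
      plugged t rewrite ++-identityʳ (pre o′ ++ t ++ suf o′) = ++-regroup (pre o) (pre o′) t (suf o′) (suf o)

  exchange : ∀ {α w α′ w′} (o : Occurrence α w) (o′ : Occurrence α′ w′) → N o ≡ N o′ →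
             Derives α (pre o ++ yield o′ ++ suf o)
  exchange o o′ refl = subst (λ z → Derives _ (pre o ++ z ++ suf o)) (++-identityʳ (yield o′))
                         (plug o _ (production-derives (prod o′) (subtree o′)))

  length-splits : ∀ {α w} (o : Occurrence α w) → length w ≡ length (pre o) + (len o + length (suf o))
  length-splits {w = w} o = begin
    length w                            ≡⟨ cong length (splits o) ⟩
    length (pre o ++ yield o ++ suf o)  ≡⟨ length-++ (pre o) ⟩
    length (pre o) + length (yield o ++ suf o) ≡⟨ cong (length (pre o) +_) (length-++ (yield o)) ⟩
    length (pre o) + (len o + length (suf o)) ∎
    where open ≡-Reasoning

  HeavyOccurrence : List Symbol → List T → ℕ → Set
  HeavyOccurrence α w bound = Σ (Occurrence α w) λ o → size (subtree o) < bound × length w ≤ length α * len o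

  share-after-terminal : ∀ {lw} la y → lw ≤ la * y → suc lw ≤ suc la ⊎ suc lw ≤ suc la * y
  share-after-terminal la zero share = inj₁ (s≤s (≤-trans share (≤-trans (≤-reflexive (*-zeroʳ la)) z≤n)))
  share-after-terminal la (suc y) share = inj₂ (s≤s (≤-trans share (m≤n+m (la * suc y) y)))

  empty-head : ∀ {lv} la lu → ¬ lv ≤ la * lu → lv ≤ la → lu ≡ 0
  empty-head la zero _ _ = refl
  empty-head la (suc lu) heavy-tail short = ⊥-elim (heavy-tail (≤-trans short (m≤m*n la (suc lu))))

  -- Some symbol of α derives a part of w of length at least |w| / |α|; if that symbol is not a
  -- terminal, the production at its root is the heavy occurrence.
  heavy-occurrence : ∀ {α w} (D : Derives α w) → length w ≤ length α ⊎ HeavyOccurrence α w (size D)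
  heavy-occurrence d-nil = inj₁ z≤n
  heavy-occurrence {inj₂ _ ∷ α} (d-term D) with heavy-occurrence D
  ... | inj₁ short = inj₁ (s≤s short)
  ... | inj₂ (o , small , share) with share-after-terminal (length α) (len o) share
  ...   | inj₁ short = inj₁ short
  ...   | inj₂ share′ = inj₂ (occurrence-after-terminal o , small , share′)
  heavy-occurrence {inj₁ _ ∷ α} (d-nt {u = u} {v = v} p Dβ Dα) with length v ≤? length α * length u
  ... | yes light-tail =
    inj₂ (occurrence-at-head p Dβ Dα , s≤s (m≤m+n _ _) ,
          ≤-trans (≤-reflexive (length-++ u)) (+-monoʳ-≤ (length u) light-tail))
  ... | no heavy-tail with heavy-occurrence Dα
  ...   | inj₁ short =
    inj₁ (≤-trans (≤-reflexive (trans (length-++ u) (cong (_+ length v) (empty-head (length α) (length u) heavy-tail short))))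
                  (≤-trans short (n≤1+n _)))
  ...   | inj₂ (o , small , share) =
    inj₂ (occurrence-after-nonterminal p Dβ o ,
          ≤-trans small (≤-trans (m≤n+m (size Dα) (size Dβ)) (n≤1+n _)) ,
          ≤-trans (≤-reflexive (length-++ u)) (+-mono-≤ (<⇒≤ head<y) share))
    where
      head<y : length u < len o
      head<y = *-cancelˡ-< (length α) (length u) (len o) (<-≤-trans (≰⇒> heavy-tail) share)

  maxLength : List (Fin m × List Symbol) → ℕ
  maxLength [] = 0
  maxLength ((_ , β) ∷ ps) = length β ⊔ maxLength ps

  maxLength-bound : ∀ {A β} ps → (A , β) ∈ ps → length β ≤ maxLength ps
  maxLength-bound ((_ , β) ∷ ps) (here refl) = m≤m⊔n (length β) (maxLength ps)
  maxLength-bound ((_ , β) ∷ ps) (there p) = ≤-trans (maxLength-bound ps p) (m≤n⊔m (length β) (maxLength ps))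

  -- One more than the longest right-hand side, to keep it positive.
  branching : ℕ
  branching = suc (maxLength prods)

  rhs≤branching : ∀ {A β} → (A , β) ∈ prods → length β ≤ branching
  rhs≤branching p = ≤-trans (maxLength-bound prods p) (n≤1+n _)

  InWindow : ℕ → ∀ {α w} → Occurrence α w → Set
  InWindow B o = B < branching * len o × len o ≤ B

  descend : ∀ fuel B {α w} (o : Occurrence α w) → size (subtree o) < fuel → B < len o → branching ≤ B →
            Σ (Occurrence α w) (InWindow B)
  descend zero B o () long R≤B
  descend (suc fuel) B o small long R≤B with heavy-occurrence (subtree o)
  ... | inj₁ short = ⊥-elim (<-irrefl refl (≤-trans long (≤-trans short (≤-trans (rhs≤branching (prod o)) R≤B))))
  ... | inj₂ (o′ , smaller , share) with len o′ ≤? B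
  ...   | yes fits = nest o o′ , <-≤-trans long (≤-trans share (*-monoˡ-≤ (len o′) (rhs≤branching (prod o)))) , fits
  ...   | no too-long = descend fuel B (nest o o′) (≤-trans smaller (≤-pred small)) (≰⇒> too-long) R≤B

  RootOccurrence : List T → Set
  RootOccurrence = Occurrence [ inj₁ start ]

  occurrence-in-window : ∀ {w} B → LangOf G w → B < length w → branching ≤ B → Σ (RootOccurrence w) (InWindow B)
  occurrence-in-window B (d-nt {u = u} p D d-nil) long R≤B =
    descend (suc (size D)) B (occurrence-at-head p D d-nil) ≤-refl (subst (λ z → B < length z) (++-identityʳ u) long) R≤B

  shorter-occurrence : ∀ {w} (o : RootOccurrence w) → branching < len o →
                       Σ (RootOccurrence w) λ o′ → len o ≤ branching * len o′ × len o′ < len o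
  shorter-occurrence o long with len o in eq
  ... | suc l with descend (suc (size (subtree o))) l o ≤-refl (subst (l <_) (sym eq) ≤-refl) (≤-pred long)
  ...   | o′ , l<Ro′ , o′≤l = o′ , l<Ro′ , s≤s o′≤l

  -- Descending m + 1 times from an occurrence of length ≤ B, each time by a factor of at most
  -- branching, yields m + 1 occurrences of strictly decreasing lengths, two of which share a
  -- nonterminal; exchanging them removes fewer than B letters.
  module PumpingDown {w : List T} (B : ℕ) (B-large : branching ^ suc m ≤ B) (W : LangOf G w) (long : B < length w) where
    R : ℕ
    R = branching

    Stage : ℕ → Set
    Stage i = Σ (RootOccurrence w) λ o → B < R ^ i * (R * len o) × len o ≤ B

    R≤B : R ≤ B
    R≤B = ≤-trans (m≤m*n R (R ^ m) {{>-nonZero (m^n>0 R m)}}) B-large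

    advance : ∀ {i} (s : Stage i) → Σ (Stage (suc i)) λ s′ →
              len (proj₁ s′) ≤ len (proj₁ s) × (R < len (proj₁ s) → len (proj₁ s′) < len (proj₁ s))
    advance {i} (o , lower , upper) with R <? len o
    ... | no short = (o , <-≤-trans lower (≤-trans (m≤n*m _ R) (≤-reflexive (sym (*-assoc R (R ^ i) _)))) , upper) ,
                     ≤-refl , λ long′ → ⊥-elim (short long′)
    ... | yes long′ with shorter-occurrence o long′
    ...   | o′ , o≤Ro′ , o′<o = (o′ , <-≤-trans lower (≤-trans (*-monoʳ-≤ (R ^ i) (*-monoʳ-≤ R o≤Ro′)) (≤-reflexive regroup)) ,
                                ≤-trans (<⇒≤ o′<o) upper) ,
                               <⇒≤ o′<o , λ _ → o′<o
      where
        regroup : R ^ i * (R * (R * len o′)) ≡ R * R ^ i * (R * len o′)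
        regroup = trans (sym (*-assoc (R ^ i) R _)) (cong (_* (R * len o′)) (*-comm (R ^ i) R))

    stage : ∀ i → Stage i
    stage zero with occurrence-in-window B W long R≤B
    ... | o , lower , upper = o , subst (B <_) (sym (+-identityʳ _)) lower , upper
    stage (suc i) = proj₁ (advance {i} (stage i))

    L : ℕ → ℕ
    L i = len (proj₁ (stage i))

    L-large : ∀ i → i < m → R < L i
    L-large i i<m with R <? L i
    ... | yes large = large
    ... | no small = ⊥-elim (<-irrefl refl (<-≤-trans (proj₁ (proj₂ (stage i))) (≤-trans (*-monoʳ-≤ (R ^ i) (*-monoʳ-≤ R (≮⇒≥ small))) R^[i+2]≤B)))
      where
        R^[i+2]≤B : R ^ i * (R * R) ≤ B
        R^[i+2]≤B = ≤-trans (≤-reflexive (trans (*-comm (R ^ i) (R * R)) (*-assoc R R (R ^ i))))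
                            (≤-trans (^-monoʳ-≤ R {suc (suc i)} {suc m} (s≤s i<m)) B-large)

    L-antitone : ∀ i d → L (d + i) ≤ L i
    L-antitone i zero = ≤-refl
    L-antitone i (suc d) = ≤-trans (proj₁ (proj₂ (advance {d + i} (stage (d + i))))) (L-antitone i d)

    L-decreasing : ∀ i j → i < j → j ≤ m → L j < L i
    L-decreasing i j i<j j≤m = subst (λ z → L z < L i) (m∸n+n≡m i<j)
      (≤-<-trans (L-antitone (suc i) (j ∸ suc i)) (proj₂ (proj₂ (advance {i} (stage i))) (L-large i (<-≤-trans i<j j≤m))))

    L-positive : ∀ i → 0 < L i
    L-positive i = positive (L i) (proj₁ (proj₂ (stage i)))
      where
        positive : ∀ l → B < R ^ i * (R * l) → 0 < l
        positive zero lower = ⊥-elim (n≮0 (subst (B <_) (trans (cong (R ^ i *_) (*-zeroʳ R)) (*-zeroʳ (R ^ i))) lower))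
        positive (suc _) _ = s≤s z≤n

  pumping-down : ∀ {w} B → branching ^ suc m ≤ B → B < length w → LangOf G w →
                 Σ (List T) λ w′ → LangOf G w′ × length w′ < length w × length w < length w′ + B
  pumping-down {w} B B-large long W with pigeonhole (n<1+n m) (λ j → N (proj₁ (stage (toℕ j))))
    where open PumpingDown B B-large W long
  ... | i , j , i<j , same-N = pre oᵢ ++ yield oⱼ ++ suf oᵢ , exchange oᵢ oⱼ same-N , shorter , not-much-shorter
    where
      open PumpingDown B B-large W long
      oᵢ oⱼ : RootOccurrence w
      oᵢ = proj₁ (stage (toℕ i))
      oⱼ = proj₁ (stage (toℕ j))
      |w′| : length (pre oᵢ ++ yield oⱼ ++ suf oᵢ) ≡ length (pre oᵢ) + (len oⱼ + length (suf oᵢ))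
      |w′| = trans (length-++ (pre oᵢ)) (cong (length (pre oᵢ) +_) (length-++ (yield oⱼ)))
      shorter : length (pre oᵢ ++ yield oⱼ ++ suf oᵢ) < length w
      shorter = subst₂ _<_ (sym |w′|) (sym (length-splits oᵢ))
                  (+-monoʳ-< (length (pre oᵢ)) (+-monoˡ-< (length (suf oᵢ)) (L-decreasing (toℕ i) (toℕ j) i<j (≤-pred (toℕ<n j)))))
      not-much-shorter : length w < length (pre oᵢ ++ yield oⱼ ++ suf oᵢ) + B
      not-much-shorter = begin-strict
        length w                                        ≡⟨ length-splits oᵢ ⟩
        length (pre oᵢ) + (len oᵢ + length (suf oᵢ))    <⟨ +-monoʳ-< (length (pre oᵢ)) (+-monoˡ-< (length (suf oᵢ)) oᵢ<oⱼ+B) ⟩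
        length (pre oᵢ) + ((len oⱼ + B) + length (suf oᵢ)) ≡⟨ regroup (length (pre oᵢ)) (len oⱼ) (length (suf oᵢ)) B ⟩
        length (pre oᵢ) + (len oⱼ + length (suf oᵢ)) + B ≡⟨ cong (_+ B) (sym |w′|) ⟩
        length (pre oᵢ ++ yield oⱼ ++ suf oᵢ) + B       ∎
        where
          open ≤-Reasoning
          oᵢ<oⱼ+B : len oᵢ < len oⱼ + B
          oᵢ<oⱼ+B = +-mono-≤ (L-positive (toℕ j)) (proj₂ (proj₂ (stage (toℕ i))))
          regroup : ∀ p l s b → p + ((l + b) + s) ≡ p + (l + s) + b
          regroup = solve-∀

Letter : Set
Letter = Fin 8

-- Out-of-range positions read the junk letter zero.
at : List Letter → ℕ → Letter
at [] _ = zero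
at (a ∷ x) zero = a
at (a ∷ x) (suc i) = at x i

Periodic : ℕ → List Letter → Set
Periodic k x = ∀ i → i + k < length x → at x i ≡ at x (i + k)

-- Eight letters, so that the 8 ^ k words of length n = 2 ^ k in Lang outnumber the n² = 4 ^ k
-- placements of a factor in a word of length n.
Lang : Language Letter
Lang x = Σ ℕ λ k → length x ≡ 2 ^ k × Periodic k x

at-extensionality : ∀ (x y : List Letter) → length x ≡ length y → (∀ i → i < length x → at x i ≡ at y i) → x ≡ y
at-extensionality [] [] _ _ = refl
at-extensionality (a ∷ x) (b ∷ y) eq agree =
  cong₂ _∷_ (agree 0 (s≤s z≤n)) (at-extensionality x y (suc-injective eq) (λ i lt → agree (suc i) (s≤s lt)))

at-++ˡ : ∀ (U V : List Letter) i → i < length U → at (U ++ V) i ≡ at U i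
at-++ˡ (a ∷ U) V zero lt = refl
at-++ˡ (a ∷ U) V (suc i) (s≤s lt) = at-++ˡ U V i lt

at-++ʳ : ∀ (U V : List Letter) j → at (U ++ V) (length U + j) ≡ at V j
at-++ʳ [] V j = refl
at-++ʳ (a ∷ U) V j = at-++ʳ U V j

at-++-skip : ∀ (V V′ W : List Letter) p → length V ≡ length V′ → length V ≤ p → at (V ++ W) p ≡ at (V′ ++ W) p
at-++-skip [] [] W p _ _ = refl
at-++-skip (_ ∷ V) (_ ∷ V′) W (suc p) same (s≤s le) = at-++-skip V V′ W p (suc-injective same) le

at-outside-middle : ∀ (U V V′ W : List Letter) p → length V ≡ length V′ → p < length U ⊎ length U + length V ≤ p →
                    at (U ++ V ++ W) p ≡ at (U ++ V′ ++ W) p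
at-outside-middle [] V V′ W p same (inj₂ le) = at-++-skip V V′ W p same le
at-outside-middle (u ∷ U) V V′ W zero same outside = refl
at-outside-middle (u ∷ U) V V′ W (suc p) same (inj₁ (s≤s lt)) = at-outside-middle U V V′ W p same (inj₁ lt)
at-outside-middle (u ∷ U) V V′ W (suc p) same (inj₂ (s≤s le)) = at-outside-middle U V V′ W p same (inj₂ le)

at-middle : ∀ (U U′ V W W′ : List Letter) p → length U ≡ length U′ → length U ≤ p → p < length U + length V →
            at (U ++ V ++ W) p ≡ at (U′ ++ V ++ W′) p
at-middle [] [] V W W′ p _ _ lt = trans (at-++ˡ V W p lt) (sym (at-++ˡ V W′ p lt))
at-middle (_ ∷ U) (_ ∷ U′) V W W′ (suc p) same (s≤s le) (s≤s lt) = at-middle U U′ V W W′ p (suc-injective same) le lt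

at-applyUpTo : ∀ f n i → i < n → at (applyUpTo f n) i ≡ f i
at-applyUpTo f (suc n) zero lt = refl
at-applyUpTo f (suc n) (suc i) (s≤s lt) = at-applyUpTo (λ j → f (suc j)) n i lt

n<2^n : ∀ n → n < 2 ^ n
n<2^n zero = s≤s z≤n
n<2^n (suc n) = begin-strict
  suc n         ≤⟨ n<2^n n ⟩
  2 ^ n         <⟨ m<m+n (2 ^ n) (m^n>0 2 n) ⟩
  2 ^ n + 2 ^ n ≡⟨ cong (2 ^ n +_) (sym (+-identityʳ (2 ^ n))) ⟩
  2 ^ suc n     ∎
  where open ≤-Reasoning

module Periodicity (k′ : ℕ) where
  k : ℕ
  k = suc k′

  periodic-shift : ∀ x → Periodic k x → ∀ t r → r + t * k < length x → at x r ≡ at x (r + t * k)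
  periodic-shift x per zero r lt = cong (at x) (sym (+-identityʳ r))
  periodic-shift x per (suc t) r lt =
    trans (periodic-shift x per t r (≤-<-trans (m≤m+n (r + t * k) k) lt′))
          (trans (per (r + t * k) lt′) (cong (at x) (shift r t)))
    where
      shift : ∀ r t → r + t * k + k ≡ r + suc t * k
      shift r t = lemma r t k′
        where
          lemma : ∀ r t k′ → r + t * suc k′ + suc k′ ≡ r + suc t * suc k′
          lemma = solve-∀
      lt′ : r + t * k + k < length x
      lt′ = subst (_< length x) (sym (shift r t)) lt

  -- Every position is congruent mod k to one in the window [t k, t k + k).
  periodic-≡ : ∀ x y → Periodic k x → Periodic k y → length x ≡ length y → ∀ t → t * k + k ≤ length x →
               (∀ p → t * k ≤ p → p < t * k + k → at x p ≡ at y p) → x ≡ y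
  periodic-≡ x y per-x per-y same-length t fits agree = at-extensionality x y same-length agree-everywhere
    where
      agree-everywhere : ∀ i → i < length x → at x i ≡ at y i
      agree-everywhere i lt = begin
          at x i                      ≡⟨ cong (at x) (m≡m%n+[m/n]*n i k) ⟩
          at x (i % k + (i / k) * k)  ≡⟨ sym (periodic-shift x per-x (i / k) (i % k) (subst (_< length x) (m≡m%n+[m/n]*n i k) lt)) ⟩
          at x (i % k)                ≡⟨ periodic-shift x per-x t (i % k) in-x ⟩
          at x (i % k + t * k)        ≡⟨ agree (i % k + t * k) (m≤n+m (t * k) (i % k)) in-window ⟩
          at y (i % k + t * k)        ≡⟨ sym (periodic-shift y per-y t (i % k) (subst (i % k + t * k <_) same-length in-x)) ⟩
          at y (i % k)                ≡⟨ periodic-shift y per-y (i / k) (i % k) (subst (_< length y) (m≡m%n+[m/n]*n i k) (subst (i <_) same-length lt)) ⟩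
          at y (i % k + (i / k) * k)  ≡⟨ cong (at y) (sym (m≡m%n+[m/n]*n i k)) ⟩
          at y i                      ∎
        where
          open ≡-Reasoning
          in-window : i % k + t * k < t * k + k
          in-window = subst (_< t * k + k) (+-comm (t * k) (i % k)) (+-monoʳ-< (t * k) (m%n<n i k))
          in-x : i % k + t * k < length x
          in-x = <-≤-trans in-window fits

  next-multiple : ∀ a → a ≤ suc (a / k) * k × suc (a / k) * k ≤ a + k
  next-multiple a = above , below
    where
      above : a ≤ k + (a / k) * k
      above = subst (_≤ k + (a / k) * k) (sym (m≡m%n+[m/n]*n a k)) (+-monoˡ-≤ ((a / k) * k) (<⇒≤ (m%n<n a k)))
      below : k + (a / k) * k ≤ a + k
      below = subst (k + (a / k) * k ≤_) (+-comm k a) (+-monoʳ-≤ k (m/n*n≤m a k))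

  periodic-≡-on-interval : ∀ x y → Periodic k x → Periodic k y → length x ≡ length y → ∀ a → a + (k + k) ≤ length x →
                           (∀ p → a ≤ p → p < a + (k + k) → at x p ≡ at y p) → x ≡ y
  periodic-≡-on-interval x y per-x per-y same-length a fits agree =
    periodic-≡ x y per-x per-y same-length t window-fits
      (λ p start≤p p<end → agree p (≤-trans (proj₁ (next-multiple a)) start≤p) (<-≤-trans p<end window-inside))
    where
      t : ℕ
      t = suc (a / k)
      window-inside : t * k + k ≤ a + (k + k)
      window-inside = ≤-trans (+-monoˡ-≤ k (proj₂ (next-multiple a))) (≤-reflexive (+-assoc a k k))
      window-fits : t * k + k ≤ length x
      window-fits = ≤-trans window-inside fits

  periodic-splice-≡ : ∀ x y z → Periodic k x → Periodic k y → Periodic k z →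
                      length x ≡ length z → length z ≡ length y → ∀ a l → a + l ≤ length x → k + k ≤ l →
                      k ≤ a ⊎ a + l + (k + k) ≤ length x →
                      (∀ p → p < a ⊎ a + l ≤ p → at x p ≡ at z p) → (∀ p → a ≤ p → p < a + l → at z p ≡ at y p) →
                      x ≡ y
  periodic-splice-≡ x y z per-x per-y per-z |x|≡|z| |z|≡|y| a l inside long room outer inner = trans x≡z z≡y
    where
      z≡y : z ≡ y
      z≡y = periodic-≡-on-interval z y per-z per-y |z|≡|y| a
              (≤-trans (+-monoʳ-≤ a long) (subst (a + l ≤_) |x|≡|z| inside))
              (λ p a≤p p<end → inner p a≤p (<-≤-trans p<end (+-monoʳ-≤ a long)))
      x≡z : x ≡ z
      x≡z = [ (λ k≤a → periodic-≡ x z per-x per-z |x|≡|z| 0 (≤-trans k≤a (≤-trans (m≤m+n a l) inside))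
                         (λ p _ p<k → outer p (inj₁ (<-≤-trans p<k k≤a))))
            , (λ fits → periodic-≡-on-interval x z per-x per-z |x|≡|z| (a + l) fits
                         (λ p end≤p _ → outer p (inj₂ end≤p))) ]′ room

-- A seed σ : Fin (8 ^ k) is read as k letters by finToFun.
module Seeds (k′ : ℕ) where
  k n : ℕ
  k = suc k′
  n = 2 ^ k

  seed-word : Fin (8 ^ k) → List Letter
  seed-word σ = applyUpTo (λ i → finToFun σ (fromℕ< (m%n<n i k))) n

  length-seed-word : ∀ σ → length (seed-word σ) ≡ n
  length-seed-word σ = length-applyUpTo _ n

  seed-word-∈-Lang : ∀ σ → Lang (seed-word σ)
  seed-word-∈-Lang σ = k , length-seed-word σ , periodic
    where
      periodic : Periodic k (seed-word σ)
      periodic i lt = trans (at-applyUpTo _ n i (≤-<-trans (m≤m+n i k) lt′))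
                     (trans (cong (finToFun σ) (fromℕ<-cong _ _ (sym ([m+n]%n≡m%n i k)) _ _))
                            (sym (at-applyUpTo _ n (i + k) lt′)))
        where
          lt′ : i + k < n
          lt′ = subst (i + k <_) (length-seed-word σ) lt

  funToFin-cong : ∀ {a b} (f g : Fin a → Fin b) → (∀ i → f i ≡ g i) → funToFin f ≡ funToFin g
  funToFin-cong {zero} f g agree = refl
  funToFin-cong {suc a} f g agree =
    cong₂ combine (agree zero) (funToFin-cong (λ i → f (suc i)) (λ i → g (suc i)) (λ i → agree (suc i)))

  seed-word-injective : ∀ σ τ → seed-word σ ≡ seed-word τ → σ ≡ τ
  seed-word-injective σ τ eq =
    trans (sym (funToFin-finToFin {k} {8} σ)) (trans (funToFin-cong _ _ same-letters) (funToFin-finToFin {k} {8} τ))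
    where
      letter : ∀ ρ (j : Fin k) → at (seed-word ρ) (toℕ j) ≡ finToFun ρ j
      letter ρ j = trans (at-applyUpTo _ n (toℕ j) (<-≤-trans (toℕ<n j) (<⇒≤ (n<2^n k))))
                         (cong (finToFun ρ) (trans (fromℕ<-cong _ _ (m<n⇒m%n≡m (toℕ<n j)) _ (toℕ<n j)) (fromℕ<-toℕ j _)))
      same-letters : ∀ j → finToFun σ j ≡ finToFun τ j
      same-letters j = trans (sym (letter σ j)) (trans (cong (λ z → at z (toℕ j)) eq) (letter τ j))

module _ {A B : Set} where
  map-proj₁-zip : ∀ (xs : List A) (ys : List B) → length xs ≤ length ys → map proj₁ (zip xs ys) ≡ xs
  map-proj₁-zip [] ys _ = refl
  map-proj₁-zip (x ∷ xs) (y ∷ ys) (s≤s le) = cong (x ∷_) (map-proj₁-zip xs ys le)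

  map-proj₂-zip : ∀ (xs : List A) (ys : List B) → length ys ≤ length xs → map proj₂ (zip xs ys) ≡ ys
  map-proj₂-zip [] [] _ = refl
  map-proj₂-zip (x ∷ xs) [] _ = refl
  map-proj₂-zip (x ∷ xs) (y ∷ ys) (s≤s le) = cong (y ∷_) (map-proj₂-zip xs ys le)

  zip-map-proj : ∀ (ps : List (A × B)) → zip (map proj₁ ps) (map proj₂ ps) ≡ ps
  zip-map-proj [] = refl
  zip-map-proj (p ∷ ps) = cong (p ∷_) (zip-map-proj ps)

  length-zip : ∀ (xs : List A) (ys : List B) → length xs ≡ length ys → length (zip xs ys) ≡ length xs
  length-zip [] ys _ = refl
  length-zip (x ∷ xs) (y ∷ ys) same = cong suc (length-zip xs ys (suc-injective same))

++-injective : ∀ {A : Set} (a a′ r r′ : List A) → a ++ r ≡ a′ ++ r′ → length a ≡ length a′ → a ≡ a′ × r ≡ r′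
++-injective [] [] r r′ eq _ = refl , eq
++-injective (x ∷ a) (y ∷ a′) r r′ eq same with ∷-injective eq
... | x≡y , eq′ with ++-injective a a′ r r′ eq′ (suc-injective same)
...   | a≡a′ , r≡r′ = cong₂ _∷_ x≡y a≡a′ , r≡r′

map-++₃ : ∀ {A B : Set} (f : A → B) a b c → map f (a ++ b ++ c) ≡ map f a ++ map f b ++ map f c
map-++₃ f a b c = trans (map-++ f a (b ++ c)) (cong (map f a ++_) (map-++ f b c))

-- A grammar reading a word together with its advice track cannot tell two words apart if it
-- derives, at the same position and with the same length, the same nonterminal in both;
-- exchanging these subwords gives the derivation of a spliced word on the same advice.
module Splicing {g : ℕ} (G : CFG (Letter × Fin g)) where
  open Derivations G
  open Occurrence

  firsts-splits : ∀ {α x} {hs : List (Fin g)} → length x ≤ length hs → (o : Occurrence α (track x hs)) →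
                  x ≡ map proj₁ (pre o) ++ map proj₁ (yield o) ++ map proj₁ (suf o)
  firsts-splits {x = x} {hs} le o = trans (sym (map-proj₁-zip x hs le)) (trans (cong (map proj₁) (splits o)) (map-++₃ proj₁ (pre o) (yield o) (suf o)))

  seconds-splits : ∀ {α x} {hs : List (Fin g)} → length hs ≤ length x → (o : Occurrence α (track x hs)) →
                   hs ≡ map proj₂ (pre o) ++ map proj₂ (yield o) ++ map proj₂ (suf o)
  seconds-splits {x = x} {hs} le o = trans (sym (map-proj₂-zip x hs le)) (trans (cong (map proj₂) (splits o)) (map-++₃ proj₂ (pre o) (yield o) (suf o)))

  module _ {x y : List Letter} {hs : List (Fin g)} (|x| : length x ≡ length hs) (|y| : length y ≡ length hs)
           (ox : RootOccurrence (track x hs)) (oy : RootOccurrence (track y hs))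
           (same-pre : length (pre ox) ≡ length (pre oy)) (same-len : len ox ≡ len oy) where

    splice : List Letter
    splice = map proj₁ (pre ox ++ yield oy ++ suf ox)

    same-advice : map proj₂ (yield ox) ≡ map proj₂ (yield oy)
    same-advice = proj₁ (++-injective (map proj₂ (yield ox)) (map proj₂ (yield oy)) (map proj₂ (suf ox)) (map proj₂ (suf oy))
                           rest-eq (trans (length-map proj₂ (yield ox)) (trans same-len (sym (length-map proj₂ (yield oy))))))
      where
        rest-eq : map proj₂ (yield ox) ++ map proj₂ (suf ox) ≡ map proj₂ (yield oy) ++ map proj₂ (suf oy)
        rest-eq = proj₂ (++-injective (map proj₂ (pre ox)) (map proj₂ (pre oy)) _ _
                    (trans (sym (seconds-splits (≤-reflexive (sym |x|)) ox)) (seconds-splits (≤-reflexive (sym |y|)) oy))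
                    (trans (length-map proj₂ (pre ox)) (trans same-pre (sym (length-map proj₂ (pre oy))))))

    seconds-splice : map proj₂ (pre ox ++ yield oy ++ suf ox) ≡ hs
    seconds-splice = trans (map-++₃ proj₂ (pre ox) (yield oy) (suf ox))
                       (trans (cong (λ z → map proj₂ (pre ox) ++ z ++ map proj₂ (suf ox)) (sym same-advice))
                              (sym (seconds-splits (≤-reflexive (sym |x|)) ox)))

    length-splice : length splice ≡ length hs
    length-splice = trans (length-map proj₁ spliced) (trans (sym (length-map proj₂ spliced)) (cong length seconds-splice))
      where
        spliced : List (Letter × Fin g)
        spliced = pre ox ++ yield oy ++ suf ox

    splice-∈ : N ox ≡ N oy → LangOf G (track splice hs)
    splice-∈ same-N = subst (LangOf G) (sym track-splice) (exchange ox oy same-N)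
      where
        track-splice : track splice hs ≡ pre ox ++ yield oy ++ suf ox
        track-splice = trans (cong (zip splice) (sym seconds-splice)) (zip-map-proj _)

    at-splice-outside : ∀ p → p < length (pre ox) ⊎ length (pre ox) + len ox ≤ p → at x p ≡ at splice p
    at-splice-outside p outside = begin
      at x p                  ≡⟨ cong (λ z → at z p) (firsts-splits (≤-reflexive |x|) ox) ⟩
      at (X₁ ++ X₂ ++ X₃) p   ≡⟨ at-outside-middle X₁ X₂ Y₂ X₃ p |X₂|≡|Y₂| outside′ ⟩
      at (X₁ ++ Y₂ ++ X₃) p   ≡⟨ cong (λ z → at z p) (sym (map-++₃ proj₁ (pre ox) (yield oy) (suf ox))) ⟩
      at splice p             ∎
      where
        open ≡-Reasoning
        X₁ X₂ X₃ Y₂ : List Letter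
        X₁ = map proj₁ (pre ox)
        X₂ = map proj₁ (yield ox)
        X₃ = map proj₁ (suf ox)
        Y₂ = map proj₁ (yield oy)
        |X₂|≡|Y₂| : length X₂ ≡ length Y₂
        |X₂|≡|Y₂| = trans (length-map proj₁ (yield ox)) (trans same-len (sym (length-map proj₁ (yield oy))))
        outside′ : p < length X₁ ⊎ length X₁ + length X₂ ≤ p
        outside′ = subst₂ (λ u v → p < u ⊎ u + v ≤ p) (sym (length-map proj₁ (pre ox))) (sym (length-map proj₁ (yield ox))) outside

    at-splice-inside : ∀ p → length (pre ox) ≤ p → p < length (pre ox) + len ox → at splice p ≡ at y p
    at-splice-inside p start≤p p<end = begin
      at splice p             ≡⟨ cong (λ z → at z p) (map-++₃ proj₁ (pre ox) (yield oy) (suf ox)) ⟩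
      at (X₁ ++ Y₂ ++ X₃) p   ≡⟨ at-middle X₁ Y₁ Y₂ X₃ Y₃ p |X₁|≡|Y₁| start≤p′ p<end′ ⟩
      at (Y₁ ++ Y₂ ++ Y₃) p   ≡⟨ cong (λ z → at z p) (sym (firsts-splits (≤-reflexive |y|) oy)) ⟩
      at y p                  ∎
      where
        open ≡-Reasoning
        X₁ X₃ Y₁ Y₂ Y₃ : List Letter
        X₁ = map proj₁ (pre ox)
        X₃ = map proj₁ (suf ox)
        Y₁ = map proj₁ (pre oy)
        Y₂ = map proj₁ (yield oy)
        Y₃ = map proj₁ (suf oy)
        |X₁|≡|Y₁| : length X₁ ≡ length Y₁
        |X₁|≡|Y₁| = trans (length-map proj₁ (pre ox)) (trans same-pre (sym (length-map proj₁ (pre oy))))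
        start≤p′ : length X₁ ≤ p
        start≤p′ = subst (_≤ p) (sym (length-map proj₁ (pre ox))) start≤p
        p<end′ : p < length X₁ + length Y₂
        p<end′ = subst₂ (λ u v → p < u + v) (sym (length-map proj₁ (pre ox))) (trans same-len (sym (length-map proj₁ (yield oy)))) p<end

2^-injective : ∀ a b → 2 ^ a ≡ 2 ^ b → a ≡ b
2^-injective a b eq with <-cmp a b
... | tri< a<b _ _ = ⊥-elim (<-irrefl eq (^-monoʳ-< 2 (s≤s (s≤s z≤n)) a<b))
... | tri≈ _ a≡b _ = a≡b
... | tri> _ _ b<a = ⊥-elim (<-irrefl (sym eq) (^-monoʳ-< 2 (s≤s (s≤s z≤n)) b<a))

2^n<2^[1+n] : ∀ n → 2 ^ n < 2 ^ suc n
2^n<2^[1+n] n = ^-monoʳ-< 2 (s≤s (s≤s z≤n)) (n<1+n n)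

8^n≡[2^n]³ : ∀ n → 8 ^ n ≡ 2 ^ n * (2 ^ n * 2 ^ n)
8^n≡[2^n]³ zero = refl
8^n≡[2^n]³ (suc n) = trans (cong (8 *_) (8^n≡[2^n]³ n)) (cube (2 ^ n))
  where
    cube : ∀ N → 8 * (N * (N * N)) ≡ 2 * N * (2 * N * (2 * N))
    cube = solve-∀

few-windows : ∀ m k → 4 * m < 2 ^ k → m * (suc (2 ^ k) * suc (2 ^ k)) < 8 ^ k
few-windows m k 4m<n = begin-strict
  m * (suc n * suc n)     ≤⟨ *-monoʳ-≤ m (*-mono-≤ 1+n≤2n 1+n≤2n) ⟩
  m * (2 * n * (2 * n))   ≡⟨ regroup m n ⟩
  4 * m * (n * n)         <⟨ *-monoˡ-< (n * n) {{m*n≢0 n n {{m^n≢0 2 k}} {{m^n≢0 2 k}}}} 4m<n ⟩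
  n * (n * n)             ≡⟨ sym (8^n≡[2^n]³ k) ⟩
  8 ^ k                   ∎
  where
    open ≤-Reasoning
    n = 2 ^ k
    1+n≤2n : suc n ≤ 2 * n
    1+n≤2n = ≤-trans (+-monoˡ-≤ n (m^n>0 2 k)) (≤-reflexive (cong (n +_) (sym (+-identityʳ n))))
    regroup : ∀ m n → m * (2 * n * (2 * n)) ≡ 4 * m * (n * n)
    regroup = solve-∀

exponential-bound : ∀ X → 3 * (9 + 2 * X) * suc X ≤ 2 ^ (8 + 2 * X)
exponential-bound X = begin
  3 * (9 + 2 * X) * suc X   ≤⟨ *-monoˡ-≤ (suc X) linear ⟩
  256 * suc X * suc X       ≡⟨ *-assoc 256 (suc X) (suc X) ⟩
  256 * (suc X * suc X)     ≤⟨ *-monoʳ-≤ 256 (*-mono-≤ (n<2^n X) (n<2^n X)) ⟩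
  256 * (2 ^ X * 2 ^ X)     ≡⟨ cong (256 *_) (sym (^-distribˡ-+-* 2 X X)) ⟩
  256 * 2 ^ (X + X)         ≡⟨ sym (^-distribˡ-+-* 2 8 (X + X)) ⟩
  2 ^ (8 + (X + X))         ≡⟨ cong (λ e → 2 ^ (8 + (X + e))) (sym (+-identityʳ X)) ⟩
  2 ^ (8 + 2 * X)           ∎
  where
    open ≤-Reasoning
    linear : 3 * (9 + 2 * X) ≤ 256 * suc X
    linear = m+n≤o⇒m≤o (3 * (9 + 2 * X)) (≤-reflexive (slack X))
      where
        slack : ∀ X → 3 * (9 + 2 * X) + (229 + 250 * X) ≡ 256 * suc X
        slack = solve-∀

module NotInAdvice {g : ℕ} (h : ℕ → List (Fin g)) (|h| : ∀ n → length (h n) ≡ n)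
                   (G : CFG (Letter × Fin g)) (Lang⇔G : ∀ x → Lang x ⇔ LangOf G (track x (h (length x)))) where
  open Derivations G
  open Occurrence
  open Splicing G

  module Collision (k′ : ℕ) (period-fits : 3 * suc k′ * branching ≤ 2 ^ k′) (few-nonterminals : 4 * CFG.m G < 2 ^ suc k′) where
    open Seeds k′
    open Periodicity k′ hiding (k)

    B : ℕ
    B = 2 ^ k′

    hs : List (Fin g)
    hs = h n

    seed-derived : ∀ σ → LangOf G (track (seed-word σ) hs)
    seed-derived σ = subst (λ l → LangOf G (track (seed-word σ) (h l))) (length-seed-word σ)
                       (Equivalence.to (Lang⇔G (seed-word σ)) (seed-word-∈-Lang σ))

    derived-periodic : ∀ z → length z ≡ n → LangOf G (track z hs) → Periodic k z
    derived-periodic z |z| D with Equivalence.from (Lang⇔G z) (subst (λ l → LangOf G (track z (h l))) (sym |z|) D)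
    ... | k₂ , |z|≡2^k₂ , periodic = subst (λ q → Periodic q z) (2^-injective k₂ k (trans (sym |z|≡2^k₂) |z|)) periodic

    length-track : ∀ σ → length (track (seed-word σ) hs) ≡ n
    length-track σ = trans (length-zip (seed-word σ) hs (trans (length-seed-word σ) (sym (|h| n)))) (length-seed-word σ)

    window : ∀ σ → Σ (RootOccurrence (track (seed-word σ) hs)) (InWindow B)
    window σ = occurrence-in-window B (seed-derived σ) (subst (B <_) (sym (length-track σ)) (2^n<2^[1+n] k′))
                 (≤-trans (m≤n*m branching (3 * k)) period-fits)

    occ : ∀ σ → RootOccurrence (track (seed-word σ) hs)
    occ σ = proj₁ (window σ)

    pre+yield≤n : ∀ σ → length (pre (occ σ)) + len (occ σ) ≤ n
    pre+yield≤n σ = m+n≤o⇒m≤o (length (pre o) + len o)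
      (≤-reflexive (trans (+-assoc (length (pre o)) (len o) (length (suf o))) (trans (sym (length-splits o)) (length-track σ))))
      where
        o : RootOccurrence (track (seed-word σ) hs)
        o = occ σ

    position : ∀ σ → Fin (suc n)
    position σ = fromℕ< (s≤s (m+n≤o⇒m≤o (length (pre (occ σ))) (pre+yield≤n σ)))

    yield-length : ∀ σ → Fin (suc n)
    yield-length σ = fromℕ< (s≤s (≤-trans (m≤n+m (len (occ σ)) (length (pre (occ σ)))) (pre+yield≤n σ)))

    signature : Fin (8 ^ k) → Fin (CFG.m G * (suc n * suc n))
    signature σ = combine (N (occ σ)) (combine (position σ) (yield-length σ))

    yield-long : ∀ σ → k + k ≤ len (occ σ)
    yield-long σ with k + k ≤? len (occ σ)
    ... | yes long = long
    ... | no short = ⊥-elim (<-irrefl refl (<-≤-trans (proj₁ (proj₂ (window σ))) (≤-trans (*-monoʳ-≤ branching (<⇒≤ (≰⇒> short))) bound)))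
      where
        bound : branching * (k + k) ≤ B
        bound = ≤-trans (m+n≤o⇒m≤o _ (≤-reflexive (regroup branching k))) period-fits
          where
            regroup : ∀ R k → R * (k + k) + R * k ≡ 3 * k * R
            regroup = solve-∀

    room : ∀ σ → k ≤ length (pre (occ σ)) ⊎ length (pre (occ σ)) + len (occ σ) + (k + k) ≤ n
    room σ with k ≤? length (pre (occ σ))
    ... | yes before = inj₁ before
    ... | no not-before = inj₂ (begin
      length (pre (occ σ)) + len (occ σ) + (k + k) ≤⟨ +-monoˡ-≤ (k + k) (+-mono-≤ (<⇒≤ (≰⇒> not-before)) (proj₂ (proj₂ (window σ)))) ⟩
      k + B + (k + k)                              ≡⟨ regroup k B ⟩
      B + 3 * k                                    ≤⟨ +-monoʳ-≤ B (≤-trans (m≤m*n (3 * k) branching) period-fits) ⟩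
      B + B                                        ≡⟨ cong (B +_) (sym (+-identityʳ B)) ⟩
      n                                            ∎)
      where
        open ≤-Reasoning
        regroup : ∀ k B → k + B + (k + k) ≡ B + 3 * k
        regroup = solve-∀

    same-signature⇒same-seed : ∀ σ τ → signature σ ≡ signature τ → σ ≡ τ
    same-signature⇒same-seed σ τ same-signature = seed-word-injective σ τ x≡y
      where
        x y : List Letter
        x = seed-word σ
        y = seed-word τ
        split-signature : N (occ σ) ≡ N (occ τ) × combine (position σ) (yield-length σ) ≡ combine (position τ) (yield-length τ)
        split-signature = combine-injective (N (occ σ)) (combine (position σ) (yield-length σ))
                                            (N (occ τ)) (combine (position τ) (yield-length τ)) same-signature
        same-place : position σ ≡ position τ × yield-length σ ≡ yield-length τ
        same-place = combine-injective (position σ) (yield-length σ) (position τ) (yield-length τ) (proj₂ split-signature)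
        same-pre : length (pre (occ σ)) ≡ length (pre (occ τ))
        same-pre = trans (sym (toℕ-fromℕ< _)) (trans (cong toℕ (proj₁ same-place)) (toℕ-fromℕ< _))
        same-len : len (occ σ) ≡ len (occ τ)
        same-len = trans (sym (toℕ-fromℕ< _)) (trans (cong toℕ (proj₂ same-place)) (toℕ-fromℕ< _))
        |x| : length x ≡ length hs
        |x| = trans (length-seed-word σ) (sym (|h| n))
        |y| : length y ≡ length hs
        |y| = trans (length-seed-word τ) (sym (|h| n))
        z : List Letter
        z = splice |x| |y| (occ σ) (occ τ) same-pre same-len
        |z| : length z ≡ n
        |z| = trans (length-splice |x| |y| (occ σ) (occ τ) same-pre same-len) (|h| n)
        x≡y : x ≡ y
        x≡y = periodic-splice-≡ x y z
                (proj₂ (proj₂ (seed-word-∈-Lang σ))) (proj₂ (proj₂ (seed-word-∈-Lang τ)))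
                (derived-periodic z |z| (splice-∈ |x| |y| (occ σ) (occ τ) same-pre same-len (proj₁ split-signature)))
                (trans (length-seed-word σ) (sym |z|)) (trans |z| (sym (length-seed-word τ)))
                (length (pre (occ σ))) (len (occ σ)) (subst (length (pre (occ σ)) + len (occ σ) ≤_) (sym (length-seed-word σ)) (pre+yield≤n σ))
                (yield-long σ) (subst (λ l → k ≤ length (pre (occ σ)) ⊎ length (pre (occ σ)) + len (occ σ) + (k + k) ≤ l) (sym (length-seed-word σ)) (room σ))
                (at-splice-outside |x| |y| (occ σ) (occ τ) same-pre same-len)
                (at-splice-inside |x| |y| (occ σ) (occ τ) same-pre same-len)

    collision : ⊥
    collision =
      let σ , τ , σ<τ , same-signature = pigeonhole (few-windows (CFG.m G) k few-nonterminals) signature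
      in <-irrefl (cong toℕ (same-signature⇒same-seed σ τ same-signature)) σ<τ

  no-advice : ⊥
  no-advice = Collision.collision k′ (≤-trans (*-monoʳ-≤ (3 * suc k′) R≤1+X) (exponential-bound X)) few-nonterminals
    where
      X k′ : ℕ
      X = branching + CFG.m G
      k′ = 8 + 2 * X
      R≤1+X : branching ≤ suc X
      R≤1+X = ≤-trans (m≤m+n branching (CFG.m G)) (n≤1+n X)
      few-nonterminals : 4 * CFG.m G < 2 ^ suc k′
      few-nonterminals = begin-strict
        4 * CFG.m G          ≤⟨ *-monoʳ-≤ 4 (m≤n+m (CFG.m G) branching) ⟩
        4 * X                <⟨ m+n≤o⇒m≤o (suc (4 * X)) (≤-reflexive (slack X)) ⟩
        3 * (9 + 2 * X)      ≤⟨ m≤m*n (3 * (9 + 2 * X)) (suc X) ⟩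
        3 * (9 + 2 * X) * suc X ≤⟨ exponential-bound X ⟩
        2 ^ k′               <⟨ 2^n<2^[1+n] k′ ⟩
        2 ^ suc k′           ∎
        where
          open ≤-Reasoning
          slack : ∀ X → suc (4 * X) + (26 + 2 * X) ≡ 3 * (9 + 2 * X)
          slack = solve-∀

Lang∉CFL/n : ¬ InAdvice IsCFL Lang
Lang∉CFL/n (g , h , |h| , A , (G , A≐G) , Lang⇔A) = NotInAdvice.no-advice h |h| G Lang⇔G
  where
    Lang⇔G : ∀ x → Lang x ⇔ LangOf G (track x (h (length x)))
    Lang⇔G x = mk⇔ (λ l → Equivalence.to (A≐G _) (Equivalence.to (Lang⇔A x) l))
                   (λ d → Equivalence.from (Lang⇔A x) (Equivalence.from (A≐G _) d))

increment : List Bool → List Bool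
increment [] = true ∷ []
increment (false ∷ r) = true ∷ r
increment (true ∷ r) = false ∷ increment r

binary : ℕ → List Bool
binary zero = false ∷ []
binary (suc v) = increment (binary v)

value : List Bool → ℕ
value [] = 0
value (false ∷ r) = 2 * value r
value (true ∷ r) = suc (2 * value r)

value-increment : ∀ bs → value (increment bs) ≡ suc (value bs)
value-increment [] = refl
value-increment (false ∷ r) = refl
value-increment (true ∷ r) = trans (cong (2 *_) (value-increment r)) (cong suc (+-suc (value r) (value r + 0)))

value-binary : ∀ v → value (binary v) ≡ v
value-binary zero = refl
value-binary (suc v) = trans (value-increment (binary v)) (cong suc (value-binary v))

data Positive : List Bool → Set where
  positive-1 : Positive (true ∷ [])
  positive-∷ : ∀ b r → Positive r → Positive (b ∷ r)

Positive-increment : ∀ bs → Positive bs → Positive (increment bs)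
Positive-increment .(true ∷ []) positive-1 = positive-∷ false _ positive-1
Positive-increment .(false ∷ r) (positive-∷ false r p) = positive-∷ true r p
Positive-increment .(true ∷ r) (positive-∷ true r p) = positive-∷ false _ (Positive-increment r p)

Positive-binary : ∀ v → Positive (binary (suc v))
Positive-binary zero = positive-1
Positive-binary (suc v) = Positive-increment _ (Positive-binary v)

2^length≤2*value : ∀ bs → Positive bs → 2 ^ length bs ≤ 2 * value bs
2^length≤2*value .(true ∷ []) positive-1 = ≤-refl
2^length≤2*value .(b ∷ r) (positive-∷ b r p) = ≤-trans (*-monoʳ-≤ 2 (2^length≤2*value r p)) (*-monoʳ-≤ 2 (2*value≤value b))
  where
    2*value≤value : ∀ b → 2 * value r ≤ value (b ∷ r)
    2*value≤value false = ≤-refl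
    2*value≤value true = n≤1+n _

value-positive : ∀ bs → Positive bs → 1 ≤ value bs
value-positive .(true ∷ []) positive-1 = s≤s z≤n
value-positive .(false ∷ r) (positive-∷ false r p) = ≤-trans (value-positive r p) (m≤m+n (value r) _)
value-positive .(true ∷ r) (positive-∷ true r p) = s≤s z≤n

length-binary : ∀ w → length (binary (suc w)) ≤ suc ⌊log₂ (suc w) ⌋
length-binary w = ≤-trans (≤-reflexive (sym (⌊log₂[2^n]⌋≡n L)))
              (≤-trans (⌊log₂⌋-mono-≤ (≤-trans (2^length≤2*value _ (Positive-binary w)) (≤-reflexive (cong (2 *_) (value-binary (suc w))))))
                (≤-reflexive (⌊log₂[2*b]⌋≡1+⌊log₂b⌋ (suc w))))
  where
    L : ℕ
    L = length (binary (suc w))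

lowest-one : ∀ bs → Positive bs → Σ ℕ λ j → Σ (List Bool) λ rest → bs ≡ replicate j false ++ true ∷ rest × (rest ≡ [] ⊎ Positive rest)
lowest-one .(true ∷ []) positive-1 = 0 , [] , refl , inj₁ refl
lowest-one .(true ∷ r) (positive-∷ true r p) = 0 , r , refl , inj₂ p
lowest-one .(false ∷ r) (positive-∷ false r p) with lowest-one r p
... | (j , rest , e , h) = suc j , rest , cong (false ∷_) e , h

value-zeros : ∀ j r → value (replicate j false ++ r) ≡ 2 ^ j * value r
value-zeros zero r = sym (+-identityʳ (value r))
value-zeros (suc j) r = trans (cong (2 *_) (value-zeros j r)) (sym (*-assoc 2 (2 ^ j) (value r)))

2^j*odd≡2^k : ∀ j v k → 2 ^ j * suc (2 * v) ≡ 2 ^ k → v ≡ 0 × j ≡ k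
2^j*odd≡2^k zero v zero e = m+n≡0⇒m≡0 v (suc-injective (trans (sym (+-identityʳ _)) e)) , refl
2^j*odd≡2^k zero v (suc k) e = ⊥-elim (even≢odd (2 ^ k) v (sym (trans (sym (+-identityʳ _)) e)))
2^j*odd≡2^k (suc j) v zero e = ⊥-elim (even≢odd (2 ^ j * suc (2 * v)) 0 (trans (sym (*-assoc 2 (2 ^ j) (suc (2 * v)))) e))
2^j*odd≡2^k (suc j) v (suc k) e with 2^j*odd≡2^k j v k (*-cancelˡ-≡ _ _ 2 (trans (sym (*-assoc 2 (2 ^ j) _)) e))
... | (a , b) = a , cong suc b

readInput-inside : ∀ (x : List Letter) j → j < length x → readInput x (suc j) ≡ just (at x j)
readInput-inside (a ∷ x) zero _ = refl
readInput-inside (a ∷ x) (suc j) (s≤s lt) = readInput-inside x j lt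

readInput-end : ∀ (x : List Letter) → readInput x (suc (length x)) ≡ nothing
readInput-end [] = refl
readInput-end (a ∷ x) = readInput-end x

<ᵇ-true : ∀ i n → i ≤ n → (i <ᵇ suc n) ≡ true
<ᵇ-true zero n _ = refl
<ᵇ-true (suc i) (suc n) (s≤s le) = <ᵇ-true i n le

<ᵇ-self : ∀ n → (n <ᵇ n) ≡ false
<ᵇ-self zero = refl
<ᵇ-self (suc n) = <ᵇ-self n

moveIn-right : ∀ n i → i ≤ n → moveIn n right i ≡ suc i
moveIn-right n i le rewrite <ᵇ-true i n le = refl

moveIn-right-end : ∀ n → moveIn n right (suc n) ≡ suc n
moveIn-right-end n rewrite <ᵇ-self n = refl

-- COUNT, INCREMENT and RETURN keep the number of letters read in binary on the work tape;
-- SCAN and SCAN-END check that the counter reads 0 ^ j 1, i.e. that |x| = 2 ^ j, and REWIND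
-- brings the input head back.  Then, for each position i, PICK reads x i, SEEK walks both heads
-- right until the work head meets the 1 in cell j, compares with x (i + j), and RETREAT walks
-- both heads back to cell 0.
pattern ACC = zero
pattern REJ = suc zero
pattern INIT = suc (suc zero)
pattern COUNT = suc (suc (suc zero))
pattern INCREMENT = suc (suc (suc (suc zero)))
pattern RETURN = suc (suc (suc (suc (suc zero))))
pattern SCAN = suc (suc (suc (suc (suc (suc zero)))))
pattern SCAN-END = suc (suc (suc (suc (suc (suc (suc zero))))))
pattern REWIND = suc (suc (suc (suc (suc (suc (suc (suc zero)))))))
pattern PICK = suc (suc (suc (suc (suc (suc (suc (suc (suc zero))))))))
pattern RETREAT = suc (suc (suc (suc (suc (suc (suc (suc (suc (suc zero)))))))))
pattern SEEK a = suc (suc (suc (suc (suc (suc (suc (suc (suc (suc (suc a))))))))))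

-- Work symbols: blank, the bits, and the bits marked as sitting in cell 0.
pattern BL = zero
pattern B0 = suc zero
pattern B1 = suc (suc zero)
pattern M0 = suc (suc (suc zero))
pattern M1 = suc (suc (suc (suc zero)))

State WorkSymbol Action : Set
State = Fin 19
WorkSymbol = Fin 5
Action = State × Move × WorkSymbol × Move

compare-letter : Letter → Maybe Letter → WorkSymbol → Action
compare-letter a nothing c = ACC , stay , c , stay
compare-letter a (just b) c = (if does (a Fin.≟ b) then RETREAT else REJ) , stay , c , stay

transition : State → Maybe Letter → WorkSymbol → Action
transition ACC r c = ACC , stay , c , stay
transition REJ r c = REJ , stay , c , stay
transition INIT r c = COUNT , right , M0 , stay
transition COUNT nothing c = SCAN , stay , c , stay
transition COUNT (just _) c = INCREMENT , stay , c , stay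
transition INCREMENT r BL = RETURN , stay , B1 , left
transition INCREMENT r B0 = RETURN , stay , B1 , left
transition INCREMENT r B1 = INCREMENT , stay , B0 , right
transition INCREMENT r M0 = RETURN , stay , M1 , left
transition INCREMENT r M1 = INCREMENT , stay , M0 , right
transition RETURN r BL = RETURN , stay , BL , left
transition RETURN r B0 = RETURN , stay , B0 , left
transition RETURN r B1 = RETURN , stay , B1 , left
transition RETURN r M0 = COUNT , right , M0 , stay
transition RETURN r M1 = COUNT , right , M1 , stay
transition SCAN r BL = REJ , stay , BL , stay
transition SCAN r B0 = SCAN , stay , B0 , right
transition SCAN r B1 = SCAN-END , stay , B1 , right
transition SCAN r M0 = SCAN , stay , M0 , right
transition SCAN r M1 = SCAN-END , stay , M1 , right
transition SCAN-END r BL = REWIND , left , BL , left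
transition SCAN-END r B0 = REJ , stay , B0 , stay
transition SCAN-END r B1 = REJ , stay , B1 , stay
transition SCAN-END r M0 = REJ , stay , M0 , stay
transition SCAN-END r M1 = REJ , stay , M1 , stay
transition REWIND nothing c = PICK , right , c , stay
transition REWIND (just _) c = REWIND , left , c , left
transition PICK nothing c = ACC , stay , c , stay
transition PICK (just a) c = SEEK a , stay , c , stay
transition RETREAT r BL = RETREAT , left , BL , left
transition RETREAT r B0 = RETREAT , left , B0 , left
transition RETREAT r B1 = RETREAT , left , B1 , left
transition RETREAT r M0 = PICK , right , M0 , stay
transition RETREAT r M1 = PICK , right , M1 , stay
transition (SEEK a) r BL = SEEK a , right , BL , right
transition (SEEK a) r B0 = SEEK a , right , B0 , right
transition (SEEK a) r B1 = compare-letter a r B1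
transition (SEEK a) r M0 = SEEK a , right , M0 , right
transition (SEEK a) r M1 = compare-letter a r M1

machine : DTM Letter
machine = record { q = 19 ; g = 5 ; blank = BL ; init = INIT ; accept = ACC ; reject = REJ ; δ = transition }

module Execution (x : List Letter) where
  n : ℕ
  n = length x

  Cfg : Set
  Cfg = Config machine

  next : Cfg → Cfg
  next = step machine x

  step-unfold : ∀ s i t p {r : Action} → (s ≡ ACC → ⊥) → (s ≡ REJ → ⊥) → transition s (readInput x i) (t p) ≡ r →
           next (config s i t p) ≡ config (proj₁ r) (moveIn n (proj₁ (proj₂ r)) i) (write t p (proj₁ (proj₂ (proj₂ r)))) (moveWk (proj₂ (proj₂ (proj₂ r))) p)
  step-unfold s i t p nA nR eq with s Fin.≟ ACC | s Fin.≟ REJ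
  ... | yes e | _ = ⊥-elim (nA e)
  ... | no _ | yes e = ⊥-elim (nR e)
  ... | no _ | no _ rewrite eq = refl

  headOf : Cfg → ℕ
  headOf = Config.wkHead
  stateOf : Cfg → State
  stateOf = Config.state

  data Reaches (bound : ℕ) (Q : Cfg → Set) : Cfg → Set where
    arrived : ∀ {c} → Q c → headOf c ≤ bound → Reaches bound Q c
    moves : ∀ {c} → headOf c ≤ bound → (stateOf c ≡ ACC → ⊥) → Reaches bound Q (next c) → Reaches bound Q c

  chain : ∀ {bound Q₁ Q₂ c} → Reaches bound Q₁ c → (∀ {c′} → Q₁ c′ → Reaches bound Q₂ c′) → Reaches bound Q₂ c
  chain (arrived q _) f = f q
  chain (moves h ne r) f = moves h ne (chain r f)

  weaken : ∀ {Q₁ Q₂ : Cfg → Set} {bound c} → (∀ {c′} → Q₁ c′ → Q₂ c′) → Reaches bound Q₁ c → Reaches bound Q₂ c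
  weaken f (arrived q h) = arrived (f q) h
  weaken f (moves h ne r) = moves h ne (weaken f r)

  iter : ℕ → Cfg → Cfg
  iter zero c = c
  iter (suc j) c = next (iter j c)

  iter-comm : ∀ j c → iter j (next c) ≡ iter (suc j) c
  iter-comm zero c = refl
  iter-comm (suc j) c = cong next (iter-comm j c)

  reaches⇒run : ∀ {bound Q c} → Reaches bound Q c → Σ ℕ λ T → Q (iter T c) × (∀ j → j ≤ T → headOf (iter j c) ≤ bound) × (∀ j → j < T → stateOf (iter j c) ≡ ACC → ⊥)
  reaches⇒run (arrived q h) = 0 , q , (λ { zero _ → h }) , (λ _ ())
  reaches⇒run {bound} {Q} {c} (moves h ne r) with reaches⇒run r
  ... | (T , q , H , N) = suc T , subst Q (iter-comm T c) q , H' , N'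
    where
      H' : ∀ j → j ≤ suc T → headOf (iter j c) ≤ bound
      H' zero _ = h
      H' (suc j) (s≤s le) = subst (λ z → headOf z ≤ bound) (iter-comm j c) (H j le)
      N' : ∀ j → j < suc T → stateOf (iter j c) ≡ ACC → ⊥
      N' zero _ = ne
      N' (suc j) (s≤s le) = subst (λ z → stateOf z ≡ ACC → ⊥) (iter-comm j c) (N j le)

  run≡iter : ∀ j → run machine x j ≡ iter j (initConfig machine x)
  run≡iter zero = refl
  run≡iter (suc j) = cong next (run≡iter j)

  step-then : ∀ {bound Q} s i t p {r : Action} → p ≤ bound → (s ≡ ACC → ⊥) → (s ≡ REJ → ⊥) → transition s (readInput x i) (t p) ≡ r →
          Reaches bound Q (config (proj₁ r) (moveIn n (proj₁ (proj₂ r)) i) (write t p (proj₁ (proj₂ (proj₂ r)))) (moveWk (proj₂ (proj₂ (proj₂ r))) p)) →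
          Reaches bound Q (config s i t p)
  step-then {bound} {Q} s i t p le nA nR eq R = moves le nA (subst (Reaches bound Q) (sym (step-unfold s i t p nA nR eq)) R)

mark : Bool → WorkSymbol
mark false = M0
mark true = M1

bit : Bool → WorkSymbol
bit false = B0
bit true = B1

cellSymbol : ℕ → Bool → WorkSymbol
cellSymbol zero b = mark b
cellSymbol (suc _) b = bit b

bitAt : List Bool → ℕ → Maybe Bool
bitAt [] _ = nothing
bitAt (b ∷ bs) zero = just b
bitAt (b ∷ bs) (suc c) = bitAt bs c

encodeCell : ℕ → Maybe Bool → WorkSymbol
encodeCell c nothing = BL
encodeCell c (just b) = cellSymbol c b

encode : List Bool → ℕ → WorkSymbol
encode bs c = encodeCell c (bitAt bs c)

Encodes : (ℕ → WorkSymbol) → List Bool → Set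
Encodes t bs = ∀ c → t c ≡ encode bs c

write-encodes : ∀ {t bs bs' p w} → Encodes t bs → w ≡ encode bs' p → (∀ c → (c ≡ p → ⊥) → bitAt bs c ≡ bitAt bs' c) → Encodes (write t p w) bs'
write-encodes {t} {bs} {bs'} {p} {w} R we hb c with c ≟ p
... | yes refl = we
... | no ne = trans (R c) (cong (encodeCell c) (hb c ne))

write-encoded : ∀ {t bs} p w → Encodes t bs → w ≡ encode bs p → Encodes (write t p w) bs
write-encoded {t} {bs} p w R we = write-encodes {t} {bs} {bs} R we (λ _ _ → refl)

write-unchanged : ∀ {t bs} p → Encodes t bs → Encodes (write t p (t p)) bs
write-unchanged {t} {bs} p R = write-encodes {t} {bs} {bs} R (R p) (λ _ _ → refl)

bitAt-mid : ∀ (U : List Bool) b r → bitAt (U ++ b ∷ r) (length U) ≡ just b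
bitAt-mid [] b r = refl
bitAt-mid (u ∷ U) b r = bitAt-mid U b r

bitAt-other : ∀ (U : List Bool) b b' r c → (c ≡ length U → ⊥) → bitAt (U ++ b ∷ r) c ≡ bitAt (U ++ b' ∷ r) c
bitAt-other [] b b' r zero ne = ⊥-elim (ne refl)
bitAt-other [] b b' r (suc c) ne = refl
bitAt-other (u ∷ U) b b' r zero ne = refl
bitAt-other (u ∷ U) b b' r (suc c) ne = bitAt-other U b b' r c (λ e → ne (cong suc e))

bitAt-end : ∀ (U : List Bool) → bitAt U (length U) ≡ nothing
bitAt-end [] = refl
bitAt-end (u ∷ U) = bitAt-end U

bitAt-app : ∀ (U : List Bool) b c → (c ≡ length U → ⊥) → bitAt U c ≡ bitAt (U ++ b ∷ []) c
bitAt-app [] b zero ne = ⊥-elim (ne refl)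
bitAt-app [] b (suc c) ne = refl
bitAt-app (u ∷ U) b zero ne = refl
bitAt-app (u ∷ U) b (suc c) ne = bitAt-app U b c (λ e → ne (cong suc e))

bitAt-zeros : ∀ j (r : List Bool) c → c < j → bitAt (replicate j false ++ r) c ≡ just false
bitAt-zeros (suc j) r zero _ = refl
bitAt-zeros (suc j) r (suc c) (s≤s lt) = bitAt-zeros j r c lt

encode-mid : ∀ (U : List Bool) b r → encode (U ++ b ∷ r) (length U) ≡ cellSymbol (length U) b
encode-mid U b r = cong (encodeCell (length U)) (bitAt-mid U b r)

encode-zeros : ∀ j (r : List Bool) c → c < j → encode (replicate j false ++ r) c ≡ cellSymbol c false
encode-zeros j r c lt = cong (encodeCell c) (bitAt-zeros j r c lt)

replicate-snoc : ∀ j (r : List Bool) → replicate j false ++ false ∷ r ≡ replicate (suc j) false ++ r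
replicate-snoc zero r = refl
replicate-snoc (suc j) r = cong (false ∷_) (replicate-snoc j r)

encode-zeros-mid : ∀ j b (r : List Bool) → encode (replicate j false ++ b ∷ r) j ≡ cellSymbol j b
encode-zeros-mid j b r = subst (λ z → encode (replicate j false ++ b ∷ r) z ≡ cellSymbol z b) (length-replicate j) (encode-mid (replicate j false) b r)

bitAt-zeros-other : ∀ j b b' (r : List Bool) c → (c ≡ j → ⊥) → bitAt (replicate j false ++ b ∷ r) c ≡ bitAt (replicate j false ++ b' ∷ r) c
bitAt-zeros-other j b b' r c ne = bitAt-other (replicate j false) b b' r c (λ e → ne (trans e (length-replicate j)))

unmarked : ∀ bs c → encode bs (suc c) ≡ BL ⊎ (encode bs (suc c) ≡ B0 ⊎ encode bs (suc c) ≡ B1)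
unmarked bs c with bitAt bs (suc c)
... | nothing = inj₁ refl
... | just false = inj₂ (inj₁ refl)
... | just true = inj₂ (inj₂ refl)

δ-RETURN-unmarked : ∀ r sy → (sy ≡ BL ⊎ (sy ≡ B0 ⊎ sy ≡ B1)) → transition RETURN r sy ≡ (RETURN , stay , sy , left)
δ-RETURN-unmarked r .BL (inj₁ refl) = refl
δ-RETURN-unmarked r .B0 (inj₂ (inj₁ refl)) = refl
δ-RETURN-unmarked r .B1 (inj₂ (inj₂ refl)) = refl

δ-RETURN-mark : ∀ r b → transition RETURN r (mark b) ≡ (COUNT , right , mark b , stay)
δ-RETURN-mark r false = refl
δ-RETURN-mark r true = refl

δ-INCREMENT-1 : ∀ r c → transition INCREMENT r (cellSymbol c true) ≡ (INCREMENT , stay , cellSymbol c false , right)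
δ-INCREMENT-1 r zero = refl
δ-INCREMENT-1 r (suc c) = refl

δ-INCREMENT-0 : ∀ r c → transition INCREMENT r (cellSymbol c false) ≡ (RETURN , stay , cellSymbol c true , left)
δ-INCREMENT-0 r zero = refl
δ-INCREMENT-0 r (suc c) = refl

moveWk-left≤ : ∀ p → moveWk left p ≤ p
moveWk-left≤ zero = z≤n
moveWk-left≤ (suc p) = n≤1+n p

zeros-nonempty : ∀ c b (r : List Bool) → bitAt (replicate c false ++ b ∷ r) 0 ≡ nothing → ⊥
zeros-nonempty zero b r ()
zeros-nonempty (suc c) b r ()

module Phases (x : List Letter) where
  open Execution x

  bound : ℕ
  bound = suc ⌊log₂ n ⌋

  CountingAt : ℕ → List Bool → Cfg → Set
  CountingAt pos bs c = Σ (ℕ → WorkSymbol) λ t → c ≡ config COUNT pos t 0 × Encodes t bs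

  return-run : ∀ p i t bs → i ≤ n → Encodes t bs → p ≤ bound → (bitAt bs 0 ≡ nothing → ⊥) → Reaches bound (CountingAt (suc i) bs) (config RETURN i t p)
  return-run zero i t bs le R pb ne with bitAt bs 0 in eb
  ... | nothing = ⊥-elim (ne refl)
  ... | just b = step-then RETURN i t 0 pb (λ ()) (λ ()) (trans (cong (transition RETURN (readInput x i)) (trans (R 0) (cong (encodeCell 0) eb))) (δ-RETURN-mark _ b))
        (arrived (write t 0 (mark b) , cong (λ z → config COUNT z (write t 0 (mark b)) 0) (moveIn-right n i le) ,
               write-encodes {t} {bs} {bs} R (sym (cong (encodeCell 0) eb)) (λ _ _ → refl)) z≤n)
  return-run (suc p) i t bs le R pb ne =
    step-then RETURN i t (suc p) pb (λ ()) (λ ()) (δ-RETURN-unmarked _ (t (suc p)) (subst (λ z → z ≡ BL ⊎ (z ≡ B0 ⊎ z ≡ B1)) (sym (R (suc p))) (unmarked bs p)))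
      (return-run p i _ bs le (write-unchanged {t} {bs} (suc p) R) (≤-trans (n≤1+n p) pb) ne)

  CountingAt-≡ : ∀ {pos bs bs'} → bs ≡ bs' → ∀ {c} → CountingAt pos bs c → CountingAt pos bs' c
  CountingAt-≡ refl l = l

  increment-run : ∀ rest c i t → i ≤ n → Encodes t (replicate c false ++ rest) → 1 ≤ c + length rest →
            c + length (increment rest) ≤ suc bound →
            Reaches bound (CountingAt (suc i) (replicate c false ++ increment rest)) (config INCREMENT i t c)
  increment-run (true ∷ r) c i t le R ne bd =
    step-then INCREMENT i t c c≤Bd (λ ()) (λ ()) (trans (cong (transition INCREMENT (readInput x i)) (trans (R c) (encode-zeros-mid c true r))) (δ-INCREMENT-1 _ c))
      (weaken (CountingAt-≡ (sym (replicate-snoc c (increment r))))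
        (increment-run r (suc c) i _ le R' (s≤s z≤n) (subst (_≤ suc bound) (+-suc c (length (increment r))) bd)))
    where
      c≤Bd : c ≤ bound
      c≤Bd = ≤-pred (≤-trans (+-monoʳ-≤ 1 (m≤m+n c _)) (≤-trans (≤-reflexive (sym (+-suc c _))) bd))
      R' : Encodes (write t c (cellSymbol c false)) (replicate (suc c) false ++ r)
      R' = subst (Encodes (write t c (cellSymbol c false))) (replicate-snoc c r)
             (write-encodes {t} {replicate c false ++ true ∷ r} {replicate c false ++ false ∷ r} R (sym (encode-zeros-mid c false r))
               (λ c' ne' → bitAt-zeros-other c true false r c' ne'))
  increment-run (false ∷ r) c i t le R ne bd =
    step-then INCREMENT i t c c≤Bd (λ ()) (λ ()) (trans (cong (transition INCREMENT (readInput x i)) (trans (R c) (encode-zeros-mid c false r))) (δ-INCREMENT-0 _ c))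
      (return-run (moveWk left c) i (write t c (cellSymbol c true)) (replicate c false ++ true ∷ r) le R' (≤-trans (moveWk-left≤ c) c≤Bd) (zeros-nonempty c true r))
    where
      c≤Bd : c ≤ bound
      c≤Bd = ≤-pred (≤-trans (+-monoʳ-≤ 1 (m≤m+n c _)) (≤-trans (≤-reflexive (sym (+-suc c _))) bd))
      R' : Encodes (write t c (cellSymbol c true)) (replicate c false ++ true ∷ r)
      R' = write-encodes {t} {replicate c false ++ false ∷ r} {replicate c false ++ true ∷ r} R (sym (encode-zeros-mid c true r))
               (λ c' ne' → bitAt-zeros-other c false true r c' ne')
  increment-run [] zero i t le R () bd
  increment-run [] (suc c) i t le R ne bd =
    step-then INCREMENT i t (suc c) c≤Bd (λ ()) (λ ()) (cong (transition INCREMENT (readInput x i)) (trans (R (suc c)) blank))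
      (return-run (moveWk left (suc c)) i (write t (suc c) B1) (U ++ true ∷ []) le R' (≤-trans (moveWk-left≤ (suc c)) c≤Bd) (zeros-nonempty (suc c) true []))
    where
      U : List Bool
      U = replicate (suc c) false
      c≤Bd : suc c ≤ bound
      c≤Bd = ≤-pred (≤-trans (+-monoʳ-≤ 1 (m≤m+n (suc c) _)) (≤-trans (≤-reflexive (sym (+-suc (suc c) _))) bd))
      lU : length U ≡ suc c
      lU = length-replicate (suc c)
      blank : encode (U ++ []) (suc c) ≡ BL
      blank = cong (encodeCell (suc c)) (trans (cong (λ z → bitAt z (suc c)) (++-identityʳ U)) (subst (λ z → bitAt U z ≡ nothing) lU (bitAt-end U)))
      R' : Encodes (write t (suc c) B1) (U ++ true ∷ [])
      R' = write-encodes {t} {U ++ []} {U ++ true ∷ []} R (sym (encode-zeros-mid (suc c) true []))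
             (λ c' ne' → trans (cong (λ z → bitAt z c') (++-identityʳ U)) (bitAt-app U true c' (λ e → ne' (trans e lU))))

  ScanningAt : List Bool → Cfg → Set
  ScanningAt bs c = Σ (ℕ → WorkSymbol) λ t → c ≡ config SCAN (suc n) t 0 × Encodes t bs

  length-increment : ∀ bs → 1 ≤ length (increment bs)
  length-increment [] = s≤s z≤n
  length-increment (false ∷ r) = s≤s z≤n
  length-increment (true ∷ r) = s≤s z≤n

  length-binary-positive : ∀ v → 1 ≤ length (binary v)
  length-binary-positive zero = s≤s z≤n
  length-binary-positive (suc v) = length-increment (binary v)

  count-run : ∀ d v t → d + v ≡ n → Encodes t (binary v) → Reaches bound (ScanningAt (binary n)) (config COUNT (suc v) t 0)
  count-run zero .n t refl R =
    step-then COUNT (suc n) t 0 z≤n (λ ()) (λ ()) (cong (λ z → transition COUNT z (t 0)) (readInput-end x))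
      (arrived (write t 0 (t 0) , refl , write-unchanged {t} {binary n} 0 R) z≤n)
  count-run (suc d) v t e R =
    step-then COUNT (suc v) t 0 z≤n (λ ()) (λ ()) (cong (λ z → transition COUNT z (t 0)) (readInput-inside x v v<n))
      (chain (increment-run (binary v) 0 (suc v) (write t 0 (t 0)) v<n (write-unchanged {t} {binary v} 0 R) (length-binary-positive v) lenb)
        λ { (t'' , refl , R'') → count-run d (suc v) t'' (trans (+-suc d v) e) R'' })
    where
      v<n : v < n
      v<n = subst (v <_) e (s≤s (m≤n+m v d))
      lenb : length (increment (binary v)) ≤ suc bound
      lenb = ≤-trans (length-binary v) (≤-trans (s≤s (⌊log₂⌋-mono-≤ v<n)) (n≤1+n _))

  δ-SCAN-0 : ∀ r c → transition SCAN r (cellSymbol c false) ≡ (SCAN , stay , cellSymbol c false , right)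
  δ-SCAN-0 r zero = refl
  δ-SCAN-0 r (suc c) = refl

  δ-SCAN-1 : ∀ r c → transition SCAN r (cellSymbol c true) ≡ (SCAN-END , stay , cellSymbol c true , right)
  δ-SCAN-1 r zero = refl
  δ-SCAN-1 r (suc c) = refl

  δ-SCAN-END-bit : ∀ r b → transition SCAN-END r (bit b) ≡ (REJ , stay , bit b , stay)
  δ-SCAN-END-bit r false = refl
  δ-SCAN-END-bit r true = refl

  AtCell : State → ℕ → ℕ → List Bool → Cfg → Set
  AtCell s i c bs cf = Σ (ℕ → WorkSymbol) λ t → cf ≡ config s i t c × Encodes t bs

  scan-zeros : ∀ j rest e c t → c + e ≡ j → Encodes t (replicate j false ++ true ∷ rest) → j ≤ bound →
               Reaches bound (AtCell SCAN (suc n) j (replicate j false ++ true ∷ rest)) (config SCAN (suc n) t c)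
  scan-zeros j rest zero c t e R jB = arrived (t , cong (config SCAN (suc n) t) (trans (sym (+-identityʳ c)) e) , R) (≤-trans (≤-reflexive (trans (sym (+-identityʳ c)) e)) jB)
  scan-zeros j rest (suc e') c t e R jB =
    step-then SCAN (suc n) t c c≤ (λ ()) (λ ()) (trans (cong (transition SCAN _) (trans (R c) (encode-zeros j (true ∷ rest) c c<j))) (δ-SCAN-0 _ c))
      (scan-zeros j rest e' (suc c) _ (trans (sym (+-suc c e')) e) (write-encoded {t} {replicate j false ++ true ∷ rest} c (cellSymbol c false) R (sym (encode-zeros j (true ∷ rest) c c<j))) jB)
    where
      c<j : c < j
      c<j = subst (c <_) e (≤-trans (s≤s (m≤m+n c e')) (≤-reflexive (sym (+-suc c e'))))
      c≤ : c ≤ bound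
      c≤ = ≤-trans (<⇒≤ c<j) jB

  ruler : ℕ → List Bool
  ruler j = replicate j false ++ true ∷ []

  bitAt-ruler-end : ∀ j → bitAt (ruler j) (suc j) ≡ nothing
  bitAt-ruler-end zero = refl
  bitAt-ruler-end (suc j) = bitAt-ruler-end j

  bitAt-after : ∀ j b (r : List Bool) → bitAt (replicate j false ++ true ∷ b ∷ r) (suc j) ≡ just b
  bitAt-after zero b r = refl
  bitAt-after (suc j) b r = bitAt-after j b r

  scan-power-of-2 : ∀ j t → Encodes t (ruler j) → suc j ≤ bound → Reaches bound (AtCell REWIND n j (ruler j)) (config SCAN (suc n) t j)
  scan-power-of-2 j t R jB =
    step-then SCAN (suc n) t j (≤-trans (n≤1+n j) jB) (λ ()) (λ ()) (trans (cong (transition SCAN _) (trans (R j) (encode-zeros-mid j true []))) (δ-SCAN-1 _ j))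
      (step-then SCAN-END (suc n) t' (suc j) jB (λ ()) (λ ()) (cong (transition SCAN-END _) (trans (R' (suc j)) (cong (encodeCell (suc j)) (bitAt-ruler-end j))))
        (arrived (write t' (suc j) BL , refl , write-encoded {t'} {ruler j} (suc j) BL R' (sym (cong (encodeCell (suc j)) (bitAt-ruler-end j)))) (≤-trans (n≤1+n j) jB)))
    where
      t' : ℕ → WorkSymbol
      t' = write t j (cellSymbol j true)
      R' : Encodes t' (ruler j)
      R' = write-encoded {t} {ruler j} j (cellSymbol j true) R (sym (encode-zeros-mid j true []))

  scan-not-power-of-2 : ∀ j b r t → Encodes t (replicate j false ++ true ∷ b ∷ r) → suc j ≤ bound →
                  Reaches bound (λ c → stateOf c ≡ REJ) (config SCAN (suc n) t j)
  scan-not-power-of-2 j b r t R jB =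
    step-then SCAN (suc n) t j (≤-trans (n≤1+n j) jB) (λ ()) (λ ()) (trans (cong (transition SCAN _) (trans (R j) (encode-zeros-mid j true (b ∷ r)))) (δ-SCAN-1 _ j))
      (step-then SCAN-END (suc n) t' (suc j) jB (λ ()) (λ ()) (trans (cong (transition SCAN-END _) (trans (R' (suc j)) (cong (encodeCell (suc j)) (bitAt-after j b r)))) (δ-SCAN-END-bit _ b))
        (arrived refl jB))
    where
      t' : ℕ → WorkSymbol
      t' = write t j (cellSymbol j true)
      R' : Encodes t' (replicate j false ++ true ∷ b ∷ r)
      R' = write-encoded {t} {replicate j false ++ true ∷ b ∷ r} j (cellSymbol j true) R (sym (encode-zeros-mid j true (b ∷ r)))

  scan-zero : ∀ t → Encodes t (false ∷ []) → 1 ≤ bound → Reaches bound (λ c → stateOf c ≡ REJ) (config SCAN (suc n) t 0)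
  scan-zero t R 1≤bound =
    step-then SCAN (suc n) t 0 z≤n (λ ()) (λ ()) (cong (transition SCAN _) (R 0))
      (step-then SCAN (suc n) t' 1 1≤bound (λ ()) (λ ()) (cong (transition SCAN _) (R' 1)) (arrived refl 1≤bound))
    where
      t' : ℕ → WorkSymbol
      t' = write t 0 M0
      R' : Encodes t' (false ∷ [])
      R' = write-encoded {t} {false ∷ []} 0 M0 R refl

  rewind-run : ∀ p w t bs → p ≤ n → Encodes t bs → w ≤ bound → Reaches bound (AtCell PICK 1 (w ∸ p) bs) (config REWIND p t w)
  rewind-run zero w t bs le R wB =
    step-then REWIND 0 t w wB (λ ()) (λ ()) refl (arrived (write t w (t w) , cong (λ z → config PICK z (write t w (t w)) w) (moveIn-right n 0 z≤n) , write-unchanged {t} {bs} w R) wB)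
  rewind-run (suc p) w t bs le R wB =
    step-then REWIND (suc p) t w wB (λ ()) (λ ()) (cong (λ z → transition REWIND z (t w)) (readInput-inside x p le))
      (weaken (λ { (t2 , e , R2) → t2 , trans e (cong (λ z → config PICK 1 t2 z) (moveWk-left-∸ w p)) , R2 })
        (rewind-run p (moveWk left w) (write t w (t w)) bs (≤-trans (n≤1+n p) le) (write-unchanged {t} {bs} w R) (≤-trans (moveWk-left≤ w) wB)))
    where
      moveWk-left-∸ : ∀ w p → moveWk left w ∸ p ≡ w ∸ suc p
      moveWk-left-∸ zero p = 0∸n≡0 p
      moveWk-left-∸ (suc w) p = refl

  clamp : ℕ → ℕ
  clamp y = y ⊓ suc n

  moveIn-right-clamp : ∀ y → moveIn n right (clamp y) ≡ clamp (suc y)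
  moveIn-right-clamp y with y ≤? n
  ... | yes le = trans (cong (moveIn n right) (m≤n⇒m⊓n≡m (≤-trans le (n≤1+n n)))) (trans (moveIn-right n y le) (sym (m≤n⇒m⊓n≡m (s≤s le))))
  ... | no nle = trans (cong (moveIn n right) (m≥n⇒m⊓n≡n (≰⇒> nle))) (trans (moveIn-right-end n) (sym (m≥n⇒m⊓n≡n (s≤s (<⇒≤ (≰⇒> nle))))))

  δ-SEEK-0 : ∀ a r c → transition (SEEK a) r (cellSymbol c false) ≡ (SEEK a , right , cellSymbol c false , right)
  δ-SEEK-0 a r zero = refl
  δ-SEEK-0 a r (suc c) = refl

  δ-SEEK-1 : ∀ a r c → transition (SEEK a) r (cellSymbol c true) ≡ compare-letter a r (cellSymbol c true)
  δ-SEEK-1 a r zero = refl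
  δ-SEEK-1 a r (suc c) = refl

  δ-RETREAT-unmarked : ∀ r sy → (sy ≡ BL ⊎ (sy ≡ B0 ⊎ sy ≡ B1)) → transition RETREAT r sy ≡ (RETREAT , left , sy , left)
  δ-RETREAT-unmarked r .BL (inj₁ refl) = refl
  δ-RETREAT-unmarked r .B0 (inj₂ (inj₁ refl)) = refl
  δ-RETREAT-unmarked r .B1 (inj₂ (inj₂ refl)) = refl

  δ-RETREAT-mark : ∀ r b → transition RETREAT r (mark b) ≡ (PICK , right , mark b , stay)
  δ-RETREAT-mark r false = refl
  δ-RETREAT-mark r true = refl

  compare-letter-equal : ∀ a c → compare-letter a (just a) c ≡ (RETREAT , stay , c , stay)
  compare-letter-equal a c with a Fin.≟ a
  ... | yes _ = refl
  ... | no ne = ⊥-elim (ne refl)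

  compare-letter-different : ∀ a b c → (a ≡ b → ⊥) → compare-letter a (just b) c ≡ (REJ , stay , c , stay)
  compare-letter-different a b c ne with a Fin.≟ b
  ... | yes e = ⊥-elim (ne e)
  ... | no _ = refl

  seek-run : ∀ k a e c y t → c + e ≡ k → Encodes t (ruler k) → k ≤ bound →
             Reaches bound (AtCell (SEEK a) (clamp (y + e)) k (ruler k)) (config (SEEK a) (clamp y) t c)
  seek-run k a zero c y t e R kB = arrived (t , cong₂ (λ p q → config (SEEK a) (clamp p) t q) (sym (+-identityʳ y)) (trans (sym (+-identityʳ c)) e) , R)
                                       (≤-trans (≤-reflexive (trans (sym (+-identityʳ c)) e)) kB)
  seek-run k a (suc e') c y t e R kB =
    step-then (SEEK a) (clamp y) t c (≤-trans (<⇒≤ c<k) kB) (λ ()) (λ ()) (trans (cong (transition (SEEK a) _) (trans (R c) (encode-zeros k (true ∷ []) c c<k))) (δ-SEEK-0 a _ c))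
      (subst (λ z → Reaches bound (AtCell (SEEK a) (clamp (y + suc e')) k (ruler k)) (config (SEEK a) z (write t c (cellSymbol c false)) (suc c))) (sym (moveIn-right-clamp y))
        (subst (λ z → Reaches bound (AtCell (SEEK a) (clamp z) k (ruler k)) (config (SEEK a) (clamp (suc y)) (write t c (cellSymbol c false)) (suc c))) (sym (+-suc y e'))
          (seek-run k a e' (suc c) (suc y) _ (trans (sym (+-suc c e')) e)
             (write-encoded {t} {ruler k} c (cellSymbol c false) R (sym (encode-zeros k (true ∷ []) c c<k))) kB)))
    where
      c<k : c < k
      c<k = subst (c <_) e (≤-trans (s≤s (m≤m+n c e')) (≤-reflexive (sym (+-suc c e'))))

  retreat-run : ∀ k i d p t → p ≡ suc i + d → d ≤ k → i < n → Encodes t (ruler k) → k ≤ bound →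
            Reaches bound (AtCell PICK (suc (suc i)) 0 (ruler k)) (config RETREAT p t d)
  retreat-run k i zero .(suc i + zero) t refl dk i<n R kB with bitAt (ruler k) 0 in eb
  ... | nothing = ⊥-elim (zeros-nonempty k true [] eb)
  ... | just b =
    step-then RETREAT (suc i + 0) t 0 z≤n (λ ()) (λ ()) (trans (cong (transition RETREAT _) (trans (R 0) (cong (encodeCell 0) eb))) (δ-RETREAT-mark _ b))
      (arrived (write t 0 (mark b) , cong (λ z → config PICK z (write t 0 (mark b)) 0) (trans (moveIn-right n (suc i + 0) (subst (_≤ n) (sym (+-identityʳ (suc i))) i<n)) (cong suc (cong suc (+-identityʳ i)))) ,
             write-encoded {t} {ruler k} 0 (mark b) R (sym (cong (encodeCell 0) eb))) z≤n)
  retreat-run k i (suc d) .(suc i + suc d) t refl dk i<n R kB =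
    step-then RETREAT (suc i + suc d) t (suc d) (≤-trans dk kB) (λ ()) (λ ()) (δ-RETREAT-unmarked _ (t (suc d)) (subst (λ z → z ≡ BL ⊎ (z ≡ B0 ⊎ z ≡ B1)) (sym (R (suc d))) (unmarked (ruler k) d)))
      (retreat-run k i d (i + suc d) _ (+-suc i d) (≤-trans (n≤1+n d) dk) i<n (write-unchanged {t} {ruler k} (suc d) R) kB)

  PeriodicFrom : ℕ → ℕ → Set
  PeriodicFrom k i = ∀ j → i ≤ j → j + k < n → at x j ≡ at x (j + k)

  Decides : Set → Cfg → Set
  Decides P c = (stateOf c ≡ ACC × P) ⊎ (stateOf c ≡ REJ × (P → ⊥))

  PeriodicFrom-step : ∀ k i → at x i ≡ at x (i + k) → PeriodicFrom k (suc i) → PeriodicFrom k i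
  PeriodicFrom-step k i at-i later j i≤j in-x with m≤n⇒m<n∨m≡n i≤j
  ... | inj₁ i<j = later j i<j in-x
  ... | inj₂ refl = at-i

  Decides-map : ∀ {P Q : Set} → (P → Q) → (Q → P) → ∀ {c} → Decides P c → Decides Q c
  Decides-map to from (inj₁ (s , p)) = inj₁ (s , to p)
  Decides-map to from (inj₂ (s , ¬p)) = inj₂ (s , λ q → ¬p (from q))

  seek-compares : ∀ a k t i → Encodes t (ruler k) →
                  transition (SEEK a) (readInput x i) (t k) ≡ compare-letter a (readInput x i) (cellSymbol k true)
  seek-compares a k t i R = trans (cong (transition (SEEK a) (readInput x i)) (trans (R k) (encode-zeros-mid k true []))) (δ-SEEK-1 a _ k)

  -- Invariant: the ruler 0^k 1 sits on the work tape and x is k-periodic before position i.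
  pick-run : ∀ k d i t → d + i ≡ n → Encodes t (ruler k) → k ≤ bound → Reaches bound (Decides (PeriodicFrom k i)) (config PICK (suc i) t 0)
  pick-run k zero .n t refl R kB =
    step-then PICK (suc n) t 0 z≤n (λ ()) (λ ()) (cong (λ z → transition PICK z (t 0)) (readInput-end x))
      (arrived (inj₁ (refl , λ j le lt → ⊥-elim (<-irrefl refl (≤-trans lt (≤-trans le (m≤m+n j k)))))) z≤n)
  pick-run k (suc d) i t e R kB =
    step-then PICK (suc i) t 0 z≤n (λ ()) (λ ()) (cong (λ z → transition PICK z (t 0)) (readInput-inside x i i<n))
      (subst (λ z → Reaches bound (Decides (PeriodicFrom k i)) (config (SEEK (at x i)) z (write t 0 (t 0)) 0)) (m≤n⇒m⊓n≡m (s≤s (<⇒≤ i<n)))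
        (chain (seek-run k (at x i) k 0 (suc i) (write t 0 (t 0)) refl (write-unchanged {t} {ruler k} 0 R) kB) compare-step))
    where
      i<n : i < n
      i<n = subst (i <_) e (s≤s (m≤n+m i d))
      far : ℕ
      far = clamp (suc i + k)
      compare-step : ∀ {c} → AtCell (SEEK (at x i)) far k (ruler k) c → Reaches bound (Decides (PeriodicFrom k i)) c
      compare-step (t₂ , refl , R₂) with i + k <? n
      ... | no beyond =
        step-then (SEEK (at x i)) far t₂ k kB (λ ()) (λ ()) (trans (seek-compares (at x i) k t₂ far R₂) (cong (λ z → compare-letter (at x i) z (cellSymbol k true)) read-end))
          (arrived (inj₁ (refl , λ j le lt → ⊥-elim (beyond (≤-<-trans (+-monoˡ-≤ k le) lt)))) kB)
        where
          read-end : readInput x far ≡ nothing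
          read-end = trans (cong (readInput x) (m≥n⇒m⊓n≡n (s≤s (≮⇒≥ beyond)))) (readInput-end x)
      ... | yes within with at x i Fin.≟ at x (i + k) | trans (cong (readInput x) (m≤n⇒m⊓n≡m (<⇒≤ (s≤s within)))) (readInput-inside x (i + k) within)
      ...   | yes same | read =
        step-then (SEEK (at x i)) far t₂ k kB (λ ()) (λ ()) (trans (seek-compares (at x i) k t₂ far R₂) (trans (cong (λ z → compare-letter (at x i) z (cellSymbol k true)) read)
                                                           (subst (λ z → compare-letter (at x i) (just z) (cellSymbol k true) ≡ (RETREAT , stay , cellSymbol k true , stay)) same
                                                                  (compare-letter-equal (at x i) (cellSymbol k true)))))
          (chain (retreat-run k i k far (write t₂ k (cellSymbol k true)) (m≤n⇒m⊓n≡m (<⇒≤ (s≤s within))) ≤-refl i<n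
                    (write-encoded {t₂} {ruler k} k (cellSymbol k true) R₂ (sym (encode-zeros-mid k true []))) kB)
            λ { (t₃ , refl , R₃) → weaken {Decides (PeriodicFrom k (suc i))} {Decides (PeriodicFrom k i)}
                                          (λ {c} → Decides-map (PeriodicFrom-step k i same) (λ Pf j le → Pf j (≤-trans (n≤1+n i) le)) {c})
                                          (pick-run k d (suc i) t₃ (trans (+-suc d i) e) R₃ kB) })
      ...   | no different | read =
        step-then (SEEK (at x i)) far t₂ k kB (λ ()) (λ ()) (trans (seek-compares (at x i) k t₂ far R₂) (trans (cong (λ z → compare-letter (at x i) z (cellSymbol k true)) read)
                                                           (compare-letter-different (at x i) _ (cellSymbol k true) different)))
          (arrived (inj₂ (refl , λ Pf → different (Pf i ≤-refl within))) kB)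

  periodic⇒Lang : ∀ j → n ≡ 2 ^ j → PeriodicFrom j 0 → Lang x
  periodic⇒Lang j n≡2^j periodic = j , n≡2^j , λ i lt → periodic i z≤n lt

  Lang⇒periodic : ∀ j → n ≡ 2 ^ j → Lang x → PeriodicFrom j 0
  Lang⇒periodic j n≡2^j (k , n≡2^k , periodic) i _ lt with 2^-injective j k (trans (sym n≡2^j) n≡2^k)
  ... | refl = periodic i lt

  after-ruler : ∀ j t → n ≡ 2 ^ j → Encodes t (ruler j) → suc j ≤ bound → Reaches bound (Decides (Lang x)) (config SCAN (suc n) t j)
  after-ruler j t n≡2^j R jB =
    chain (scan-power-of-2 j t R jB) λ { (t₃ , refl , R₃) →
      chain (rewind-run n j t₃ (ruler j) ≤-refl R₃ (≤-trans (n≤1+n j) jB)) λ { (t₄ , refl , R₄) →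
        subst (λ z → Reaches bound (Decides (Lang x)) (config PICK 1 t₄ z)) (sym (m≤n⇒m∸n≡0 j≤n))
          (weaken {Decides (PeriodicFrom j 0)} {Decides (Lang x)} (λ {c} → Decides-map (periodic⇒Lang j n≡2^j) (Lang⇒periodic j n≡2^j) {c})
            (pick-run j n 0 t₄ (+-identityʳ n) R₄ (≤-trans (n≤1+n j) jB))) } }
    where
      j≤n : j ≤ n
      j≤n = ≤-trans (<⇒≤ (n<2^n j)) (≤-reflexive (sym n≡2^j))

  after-lowest-one : ∀ j rest t → n ≡ 2 ^ j * value (true ∷ rest) → (rest ≡ [] ⊎ Positive rest) →
                     Encodes t (replicate j false ++ true ∷ rest) → suc j ≤ bound → Reaches bound (Decides (Lang x)) (config SCAN (suc n) t j)
  after-lowest-one j [] t n≡2^j _ R jB = after-ruler j t (trans n≡2^j (*-identityʳ (2 ^ j))) R jB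
  after-lowest-one j (b ∷ r) t n≡2^j*odd (inj₂ positive) R jB =
    weaken {λ c → stateOf c ≡ REJ} {Decides (Lang x)} (λ rejected → inj₂ (rejected , not-power-of-2)) (scan-not-power-of-2 j b r t R jB)
    where
      not-power-of-2 : Lang x → ⊥
      not-power-of-2 (k , n≡2^k , _) = <-irrefl (sym (proj₁ (2^j*odd≡2^k j (value (b ∷ r)) k (trans (sym n≡2^j*odd) n≡2^k))))
                                                 (value-positive (b ∷ r) positive)

  after-scan : ∀ w → suc w ≡ n → ∀ t → Encodes t (binary (suc w)) → Reaches bound (Decides (Lang x)) (config SCAN (suc n) t 0)
  after-scan w e t R with lowest-one (binary (suc w)) (Positive-binary w)
  ... | j , rest , binary≡ , rest-shape =
    chain (scan-zeros j rest j 0 t refl (subst (Encodes t) binary≡ R) (≤-trans (n≤1+n j) jB))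
      λ { (t₂ , refl , R₂) → after-lowest-one j rest t₂ n≡ rest-shape R₂ jB }
    where
      n≡ : n ≡ 2 ^ j * value (true ∷ rest)
      n≡ = trans (sym e) (trans (sym (value-binary (suc w))) (trans (cong value binary≡) (value-zeros j (true ∷ rest))))
      jB : suc j ≤ bound
      jB = begin
        suc j                                        ≤⟨ s≤s (m≤m+n j (length rest)) ⟩
        suc (j + length rest)                        ≡⟨ sym (+-suc j (length rest)) ⟩
        j + length (true ∷ rest)                     ≡⟨ cong (_+ suc (length rest)) (sym (length-replicate j)) ⟩
        length (replicate j false) + length (true ∷ rest) ≡⟨ sym (length-++ (replicate j false)) ⟩
        length (replicate j false ++ true ∷ rest)    ≡⟨ cong length (sym binary≡) ⟩
        length (binary (suc w))                      ≤⟨ subst (λ z → length (binary (suc w)) ≤ suc ⌊log₂ z ⌋) e (length-binary w) ⟩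
        bound                                        ∎
        where open ≤-Reasoning

  []∉Lang : n ≡ 0 → Lang x → ⊥
  []∉Lang e (k , nk , _) = <-irrefl (trans (sym e) nk) (m^n>0 2 k)

  decides : Reaches bound (Decides (Lang x)) (initConfig machine x)
  decides = step-then INIT 0 (λ _ → BL) 0 z≤n (λ ()) (λ ()) refl
           (subst (λ z → Reaches bound (Decides (Lang x)) (config COUNT z (write (λ _ → BL) 0 M0) 0)) (sym (moveIn-right n 0 z≤n))
             (chain (count-run n 0 _ (+-identityʳ n) R1) λ { (t , refl , R) → afterCheck n refl t R }))
    where
      R1 : Encodes (write (λ _ → BL) 0 M0) (binary 0)
      R1 = write-encodes {λ _ → BL} {[]} {false ∷ []} (λ c → refl) refl (λ { zero ne → ⊥-elim (ne refl) ; (suc c) ne → refl })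
      afterCheck : ∀ m → m ≡ n → ∀ t → Encodes t (binary m) → Reaches bound (Decides (Lang x)) (config SCAN (suc n) t 0)
      afterCheck zero e t R = weaken {λ c → stateOf c ≡ REJ} {Decides (Lang x)} (λ s → inj₂ (s , []∉Lang (sym e))) (scan-zero t R (s≤s z≤n))
      afterCheck (suc w) e t R = after-scan w e t R

module Correctness (x : List Letter) where
  open Execution x
  open Phases x

  iter-+ : ∀ a b c → iter (a + b) c ≡ iter a (iter b c)
  iter-+ zero b c = refl
  iter-+ (suc a) b c = cong next (iter-+ a b c)

  halted-stays : ∀ j c → (stateOf c ≡ ACC ⊎ stateOf c ≡ REJ) → iter j c ≡ c
  halted-stays zero c _ = refl
  halted-stays (suc j) (config ACC i t p) (inj₁ refl) rewrite halted-stays j (config ACC i t p) (inj₁ refl) = refl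
  halted-stays (suc j) (config REJ i t p) (inj₂ refl) rewrite halted-stays j (config REJ i t p) (inj₂ refl) = refl

  halting-time : ℕ
  halting-time = proj₁ (reaches⇒run decides)

  final : Cfg
  final = iter halting-time (initConfig machine x)

  final-decides : Decides (Lang x) final
  final-decides = proj₁ (proj₂ (reaches⇒run decides))

  head-bounded : ∀ j → j ≤ halting-time → headOf (iter j (initConfig machine x)) ≤ bound
  head-bounded = proj₁ (proj₂ (proj₂ (reaches⇒run decides)))

  not-accepting-before : ∀ j → j < halting-time → stateOf (iter j (initConfig machine x)) ≡ ACC → ⊥
  not-accepting-before = proj₂ (proj₂ (proj₂ (reaches⇒run decides)))

  halted : stateOf final ≡ ACC ⊎ stateOf final ≡ REJ
  halted with final-decides
  ... | inj₁ (s , _) = inj₁ s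
  ... | inj₂ (s , _) = inj₂ s

  run-after-halting : ∀ t → halting-time ≤ t → run machine x t ≡ final
  run-after-halting t le = trans (run≡iter t) (trans (cong (λ z → iter z (initConfig machine x)) (sym (m∸n+n≡m le)))
                (trans (iter-+ (t ∸ halting-time) halting-time _) (halted-stays (t ∸ halting-time) final halted)))

  recognizes : Lang x ⇔ Accepts machine x
  recognizes = mk⇔ to from
    where
      to : Lang x → Accepts machine x
      to l with final-decides
      ... | inj₁ (s , _) = halting-time , trans (cong Config.state (run≡iter halting-time)) s
      ... | inj₂ (_ , nl) = ⊥-elim (nl l)
      from : Accepts machine x → Lang x
      from (t , acc) with final-decides
      ... | inj₁ (_ , l) = l
      ... | inj₂ (s , nl) with t <? halting-time
      ...   | yes lt = ⊥-elim (not-accepting-before t lt (trans (cong Config.state (sym (run≡iter t))) acc))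
      ...   | no nlt = ⊥-elim (rej≢acc (trans (sym s) (trans (cong Config.state (sym (run-after-halting t (≮⇒≥ nlt)))) acc)))
        where
          rej≢acc : REJ ≡ ACC → ⊥
          rej≢acc ()

  space-bound : ∀ t → Config.wkHead (run machine x t) ≤ 1 * ⌊log₂ (length x) ⌋ + 1
  space-bound t = ≤-trans b (≤-reflexive (trans (+-comm 1 _) (cong (_+ 1) (sym (*-identityˡ _)))))
    where
      b : Config.wkHead (run machine x t) ≤ bound
      b with t ≤? halting-time
      ... | yes le = subst (λ z → Config.wkHead z ≤ bound) (sym (run≡iter t)) (head-bounded t le)
      ... | no nle = subst (λ z → Config.wkHead z ≤ bound) (sym (run-after-halting t (<⇒≤ (≰⇒> nle)))) (head-bounded halting-time ≤-refl)

Lang∈L : InLogSpace Lang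
Lang∈L = machine , (λ x → Correctness.recognizes x) , (1 , λ x t → Correctness.space-bound x t)

at-replicate : ∀ n i → at (replicate n zero) i ≡ zero
at-replicate zero i = refl
at-replicate (suc n) zero = refl
at-replicate (suc n) (suc i) = at-replicate n i

replicate-∈-Lang : ∀ K → Lang (replicate (2 ^ K) zero)
replicate-∈-Lang K = K , length-replicate (2 ^ K) ,
                     λ i _ → trans (at-replicate (2 ^ K) i) (sym (at-replicate (2 ^ K) (i + K)))

length≤sum : ∀ {w : List Letter} ws → w ∈ ws → length w ≤ sum (map length ws)
length≤sum (v ∷ ws) (here refl) = m≤m+n (length v) _
length≤sum (v ∷ ws) (there w∈ws) = ≤-trans (length≤sum ws w∈ws) (m≤n+m _ (length v))

Lang-infinite : InfiniteLang Lang
Lang-infinite (ws , complete) =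
  <-irrefl refl (<-≤-trans (n<2^n K) (subst (_≤ K) (length-replicate (2 ^ K)) (length≤sum ws (complete (replicate (2 ^ K) zero) (replicate-∈-Lang K)))))
  where
    K : ℕ
    K = sum (map length ws)

words-of-length : ℕ → List (List Letter)
words-of-length zero = [ [] ]
words-of-length (suc j) = concatMap (λ a → map (a ∷_) (words-of-length j)) (allFin 8)

∈-words-of-length : ∀ w → w ∈ words-of-length (length w)
∈-words-of-length [] = here refl
∈-words-of-length (a ∷ w) =
  ∈-concatMap⁺ (λ b → map (b ∷_) (words-of-length (length w))) (Any.map (λ { refl → ∈-map⁺ (a ∷_) (∈-words-of-length w) }) (∈-allFin a))

words-shorter-than : ℕ → List (List Letter)
words-shorter-than zero = []
words-shorter-than (suc j) = words-of-length j ++ words-shorter-than j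

∈-words-shorter-than : ∀ w b → length w < b → w ∈ words-shorter-than b
∈-words-shorter-than w (suc b) lt with length w ≟ b
... | yes refl = ∈-++⁺ˡ (∈-words-of-length w)
... | no ≢b = ∈-++⁺ʳ (words-of-length b) (∈-words-shorter-than w b (≤∧≢⇒< (≤-pred lt) ≢b))

length-bounded⇒finite : ∀ (S : Language Letter) b → (∀ w → S w → length w < b) → FiniteLang S
length-bounded⇒finite S b bounded = words-shorter-than b , λ w Sw → ∈-words-shorter-than w b (bounded w Sw)

no-power-of-2-in-gap : ∀ a b → 2 ^ b < 2 ^ suc a → 2 ^ suc a < 2 ^ b + 2 ^ a → ⊥
no-power-of-2-in-gap a b below above with b ≤? a
... | yes b≤a = <-irrefl refl (<-≤-trans above (≤-trans (+-monoˡ-≤ (2 ^ a) (^-monoʳ-≤ 2 b≤a))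
                                                          (≤-reflexive (cong (2 ^ a +_) (sym (+-identityʳ (2 ^ a)))))))
... | no b≰a = <-irrefl refl (<-≤-trans below (^-monoʳ-≤ 2 (≰⇒> b≰a)))

2^[1+X]≤2^a : ∀ a X → 2 ^ suc X ≤ 2 ^ a → Σ ℕ λ a′ → a ≡ suc a′ × X ≤ a′
2^[1+X]≤2^a zero X le = ⊥-elim (<-irrefl refl (<-≤-trans (^-monoʳ-< 2 (s≤s (s≤s z≤n)) {0} {suc X} (s≤s z≤n)) le))
2^[1+X]≤2^a (suc a) X le with X ≤? a
... | yes X≤a = a , refl , X≤a
... | no X≰a = ⊥-elim (<-irrefl refl (<-≤-trans (^-monoʳ-< 2 (s≤s (s≤s z≤n)) (s≤s (≰⇒> X≰a))) le))

module ContextFreeSubset (S : Language Letter) (S⊆Lang : S ⊆L Lang) (G : CFG Letter) (S≐G : S ≐ LangOf G) where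
  open Derivations G

  X : ℕ
  X = branching ^ suc (CFG.m G)

  not-long : ∀ w → S w → 2 ^ suc X ≤ length w → ⊥
  not-long w Sw w-long with S⊆Lang w Sw
  ... | a , |w|≡2^a , _ with 2^[1+X]≤2^a a X (subst (2 ^ suc X ≤_) |w|≡2^a w-long)
  ...   | a′ , refl , X≤a′ with pumping-down (2 ^ a′) (≤-trans X≤a′ (<⇒≤ (n<2^n a′)))
                                 (subst (2 ^ a′ <_) (sym |w|≡2^a) (2^n<2^[1+n] a′)) (Equivalence.to (S≐G w) Sw)
  ...     | w′ , W′ , shorter , not-much-shorter with S⊆Lang w′ (Equivalence.from (S≐G w′) W′)
  ...       | b , |w′|≡2^b , _ =
    no-power-of-2-in-gap a′ b (subst₂ _<_ |w′|≡2^b |w|≡2^a shorter)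
                              (subst₂ _<_ |w|≡2^a (cong (_+ 2 ^ a′) |w′|≡2^b) not-much-shorter)

Lang-CFL-immune : Immune IsCFL Lang
Lang-CFL-immune = Lang-infinite , λ { S S⊆Lang (S-infinite , (G , S≐G)) →
  S-infinite (length-bounded⇒finite S _ (λ w Sw → ≰⇒> (ContextFreeSubset.not-long S S⊆Lang G S≐G w Sw))) }

proposition3p2 : Σ ℕ λ k → Σ (Language (Fin k)) λ L →
    InLogSpace L × ¬ InAdvice IsCFL L × Immune IsCFL L
proposition3p2 = 8 , Lang , Lang∈L , Lang∉CFL/n , Lang-CFL-immune
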